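{- Let $\mathcal{A}$ be a strongly connected $d$-dimensional VASS with at least one transition. If Algorithm 1 (described in the context) returns "non-terminating" on input $\mathcal{A}$, then $\mathcal{A}$ is non-terminating.
   Context: A $d$-dimensional VASS is a pair $\mathcal{A}=(Q,T)$ with $Q$ a finite nonempty set of states and $T\subseteq Q\times\mathbb{Z}^d\times Q$ a finite set of transitions such that every state has an outgoing transition. A configuration is $p\mathbf{v}$ with $p\in Q$, $\mathbf{v}\in\mathbb{N}^d$, of size $\max_i\mathbf{v}(i)$. A computation from $p_0\mathbf{v}_0$ is a sequence of configurations $p_0\mathbf{v}_0,\dots,p_n\mathbf{v}_n$ (vectors in $\mathbb{N}^d$) with transitions $(p_i,\mathbf{u}_{i+1},p_{i+1})\in T$ and $\mathbf{v}_{i+1}=\mathbf{v}_i+\mathbf{u}_{i+1}$; length $n$. $L(p\mathbf{v})\in\mathbb{N}\cup\{\infty\}$ is the least bound on lengths of computations from $p\mathbf{v}$; $\mathcal{L}(n)=\sup\{L(p\mathbf{v}):\text{size}(p\mathbf{v})=n\}$; $\mathcal{A}$ is non-terminating if $\mathcal{L}(n)=\infty$ for some $n$. A sub-VASS is a VASS $(Q',T')$ with $Q'\subseteq Q$, $T'\subseteq T$; strongly connected means a nonempty path between any two states; an SCC of a graph $(Q,T')$ is a maximal strongly connected sub-VASS of it. A linear map is $f(p\mathbf{v})=\mathbf{c}_f^\top\mathbf{v}+\mathbf{w}_f(p)$ with $\mathbf{c}_f\in\mathbb{Q}^d$, $\mathbf{w}_f\in\mathbb{Q}^Q$; a transition $(p,\mathbf{u},q)$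 is $f$-ranked if $\mathbf{c}_f^\top\mathbf{u}+\mathbf{w}_f(q)\le\mathbf{w}_f(p)-1$ and $f$-neutral if $\mathbf{c}_f^\top\mathbf{u}+\mathbf{w}_f(q)=\mathbf{w}_f(p)$. A QRF is a linear map with $\mathbf{c}_f\ge\vec0$ such that every transition is $f$-ranked or $f$-neutral; positive if $\mathbf{c}_f>\vec0$. Algorithm 1: set $\mathit{tight}:=\mathit{true}$ iff a positive QRF for $\mathcal{A}$ exists; $k:=\mathrm{Decompose}(\mathcal{A})$; if $k=\infty$ return "non-terminating", else return $(k,\mathit{tight})$. $\mathrm{Decompose}(\mathcal{A})$: pick a QRF $f$ maximizing the number of $f$-ranked transitions; $T_f:=$ set of $f$-neutral transitions; if $T_f$ contains all transitions return $\infty$; if $T_f=\emptyset$ return $1$; otherwise with $\mathcal{A}_1,\dots,\mathcal{A}_\ell$ all SCCs of $(Q,T_f)$ return $1+\max_i\mathrm{Decompose}(\mathcal{A}_i)$. -}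

module Defs where

open import Data.Nat as ℕ using (ℕ; zero; suc; _⊔_)
open import Data.Integer as ℤ using (ℤ; +_)
open import Data.Rational using (ℚ; 0ℚ; 1ℚ; _/_) renaming (_+_ to _+ℚ_; _*_ to _*ℚ_; _-_ to _-ℚ_; _≤_ to _≤ℚ_)
open import Data.Rational.Properties using () renaming (_≤?_ to _≤ℚ?_)
open import Data.Fin using (Fin; zero; suc)
open import Data.Fin.Subset using (Subset; _∈_; _⊆_; Nonempty; ⊤)
open import Data.Fin.Subset.Properties using (_∈?_)
open import Data.List using (List; length; filter; allFin)
open import Data.Product using (Σ; ∃; ∃-syntax; _×_; _,_)
open import Data.Sum using (_⊎_)
open import Relation.Binary.PropositionalEquality using (_≡_)
open import Relation.Nullary using (¬_)
open import Relation.Nullary.Decidable using (_×-dec_)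

sumFin : ∀ {d} → (Fin d → ℚ) → ℚ
sumFin {zero}  f = 0ℚ
sumFin {suc d} f = f zero +ℚ sumFin (λ i → f (suc i))

maxFin : ∀ {d} → (Fin d → ℕ) → ℕ
maxFin {zero}  f = 0
maxFin {suc d} f = f zero ⊔ maxFin (λ i → f (suc i))

dot : ∀ {d} → (Fin d → ℚ) → (Fin d → ℤ) → ℚ
dot c u = sumFin (λ i → c i *ℚ (u i / 1))

record VASS (d : ℕ) : Set where
  field
    nQ      : ℕ
    nT      : ℕ
    src     : Fin nT → Fin nQ
    upd     : Fin nT → Fin d → ℤ
    tgt     : Fin nT → Fin nQ
    Q-nonempty : Fin nQ
    outgoing   : ∀ p → ∃[ t ] src t ≡ p
open VASS public

Config : ∀ {d} → VASS d → Set
Config {d} A = Fin (nQ A) × (Fin d → ℕ)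

size : ∀ {d} {A : VASS d} → Config A → ℕ
size (p , v) = maxFin v

Step : ∀ {d} (A : VASS d) → Config A → Config A → Set
Step A (p , v) (q , v') =
  ∃[ t ] (src A t ≡ p × tgt A t ≡ q × (∀ i → + v' i ≡ + v i ℤ.+ upd A t i))

data Comp {d} (A : VASS d) : Config A → ℕ → Set where
  done : ∀ {c} → Comp A c 0
  step : ∀ {c c' n} → Step A c c' → Comp A c' n → Comp A c (suc n)

-- L(n) = ∞ : the lengths of computations from configurations of size n
-- are unbounded (literal unfolding of sup_{size(pv)=n} L(pv) = ∞).
LInfinite : ∀ {d} → VASS d → ℕ → Set
LInfinite A n = ∀ N → ∃[ c ] (size {A = A} c ≡ n × ∃[ k ] (N ℕ.≤ k × Comp A c k))

NonTerminating : ∀ {d} → VASS d → Set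
NonTerminating A = ∃[ n ] LInfinite A n

record SubVASS {d} (A : VASS d) : Set where
  field
    Qs       : Subset (nQ A)
    Ts       : Subset (nT A)
    closed   : ∀ t → t ∈ Ts → src A t ∈ Qs × tgt A t ∈ Qs
    nonempty : Nonempty Qs
    outgoing : ∀ p → p ∈ Qs → ∃[ t ] (t ∈ Ts × src A t ≡ p)
open SubVASS public

data Path {d} (A : VASS d) (P : Fin (nT A) → Set) : Fin (nQ A) → Fin (nQ A) → Set where
  edge : ∀ t → P t → Path A P (src A t) (tgt A t)
  cons : ∀ t {q} → P t → Path A P (tgt A t) q → Path A P (src A t) q

StronglyConnected : ∀ {d} {A : VASS d} → SubVASS A → Set
StronglyConnected {A = A} S =
  ∀ p q → p ∈ Qs S → q ∈ Qs S → Path A (λ t → t ∈ Ts S) p q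


record LinMap {d} (A : VASS d) : Set where
  field
    c : Fin d → ℚ
    w : Fin (nQ A) → ℚ
open LinMap public

Ranked : ∀ {d} {A : VASS d} → LinMap A → Fin (nT A) → Set
Ranked {A = A} f t =
  dot (c f) (upd A t) +ℚ w f (tgt A t) ≤ℚ w f (src A t) -ℚ 1ℚ

Ranked? : ∀ {d} {A : VASS d} (f : LinMap A) t → Relation.Nullary.Dec (Ranked f t)
Ranked? {A = A} f t = _ ≤ℚ? _

Neutral : ∀ {d} {A : VASS d} → LinMap A → Fin (nT A) → Set
Neutral {A = A} f t = dot (c f) (upd A t) +ℚ w f (tgt A t) ≡ w f (src A t)

IsQRF : ∀ {d} {A : VASS d} → SubVASS A → LinMap A → Set
IsQRF S f = (∀ i → 0ℚ ≤ℚ c f i) × (∀ t → t ∈ Ts S → Ranked f t ⊎ Neutral f t)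

numRanked : ∀ {d} {A : VASS d} → SubVASS A → LinMap A → ℕ
numRanked {A = A} S f =
  length (filter (λ t → (t ∈? Ts S) ×-dec Ranked? f t) (allFin (nT A)))

IsMaxQRF : ∀ {d} {A : VASS d} → SubVASS A → LinMap A → Set
IsMaxQRF S f = IsQRF S f × (∀ g → IsQRF S g → numRanked S g ℕ.≤ numRanked S f)

-- S' is an SCC of the graph (Q_S, T_f), T_f = f-neutral transitions of S
IsSCCNeutral : ∀ {d} {A : VASS d} → SubVASS A → LinMap A → SubVASS A → Set
IsSCCNeutral {A = A} S f S' =
  Qs S' ⊆ Qs S × (∀ t → t ∈ Ts S' → t ∈ Ts S × Neutral f t) × StronglyConnected S' ×
  (∀ (S'' : SubVASS A) → Qs S'' ⊆ Qs S → (∀ t → t ∈ Ts S'' → t ∈ Ts S × Neutral f t) →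
     StronglyConnected S'' → Qs S' ⊆ Qs S'' → Ts S' ⊆ Ts S'' →
     Qs S'' ⊆ Qs S' × Ts S'' ⊆ Ts S')

-- Decompose(S) returns ∞ (some run of the procedure)

data DecomposeInf {d} {A : VASS d} (S : SubVASS A) : Set where
  allNeutral : ∀ f → IsMaxQRF S f → (∀ t → t ∈ Ts S → Neutral f t) → DecomposeInf S
  recurse    : ∀ f → IsMaxQRF S f →
               ¬ (∀ t → t ∈ Ts S → Neutral f t) →
               (∃[ t ] (t ∈ Ts S × Neutral f t)) →
               ∀ S' → IsSCCNeutral S f S' → DecomposeInf S' →
               DecomposeInf S

open import Data.Fin.Subset.Properties using (∈⊤)
open import Data.Product using (proj₁; proj₂)

whole : ∀ {d} (A : VASS d) → SubVASS A
whole A = record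
  { Qs = ⊤ ; Ts = ⊤
  ; closed = λ t _ → ∈⊤ , ∈⊤
  ; nonempty = Q-nonempty A , ∈⊤
  ; outgoing = λ p _ → proj₁ (VASS.outgoing A p) , ∈⊤ , proj₂ (VASS.outgoing A p) }

StronglyConnectedVASS : ∀ {d} → VASS d → Set
StronglyConnectedVASS A = StronglyConnected (whole A)

-- Algorithm 1 returns "non-terminating" iff Decompose(A) = ∞
-- (the computation of `tight` does not affect this outcome).
Alg1ReturnsNonTerminating : ∀ {d} → VASS d → Set
Alg1ReturnsNonTerminating A = DecomposeInf (whole A)

{-# OPTIONS --safe #-}
module Submission where

-- If Decompose returns ∞, the recursion ends in a strongly connected sub-VASS S whose maximal QRF
-- ranks no transition, so no QRF of S ranks any transition. Let z count the transitions of a closed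
-- tour from a state p₀ through all states of S. The integer program asking for c ≥ 0 and w such that
-- every transition t of S has slack w(src t) - c·u_t - w(tgt t) ≥ 0 and the slacks along the tour
-- add up to at least 1 is infeasible, since a solution would be a QRF ranking a transition. By
-- Farkas' lemma (in its Fourier–Motzkin form) some circulation Y ≥ z on the transitions of S has
-- non-negative total effect Σ Y_t u_t. Splitting Y - z into closed walks and splicing them into the
-- tour gives a cycle through p₀ of non-negative effect, which can be repeated forever from a
-- configuration with large enough counters.

module Sums where
  open import Data.Nat as ℕ using (ℕ; zero; suc; _+_; _*_; _≤_; z≤n; s≤s)
  import Data.Nat.Properties as ℕP
  open import Data.Integer as ℤ using (ℤ; +_)
  import Data.Integer.Properties as ℤP
  open import Data.Fin using (Fin; zero; suc; _↑ˡ_; _↑ʳ_)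
  open import Data.Fin.Properties using (_≟_)
  open import Data.Bool using (if_then_else_)
  open import Data.Product using (∃; _,_)
  open import Data.Empty using (⊥-elim)
  open import Relation.Nullary using (yes; no; does)
  open import Relation.Binary.PropositionalEquality using (_≡_; _≢_; refl; cong; cong₂; trans; sym; subst)
  import Algebra.Properties.Semiring.Sum as SemiringSum

  module ℕΣ = SemiringSum ℕP.+-*-semiring
  module ℤΣ = SemiringSum ℤP.+-*-semiring

  open ℕΣ using () renaming (sum to ∑ℕ) public
  open ℤΣ using () renaming (sum to ∑ℤ) public

  δ : ∀ {n} → Fin n → Fin n → ℕ
  δ a b = if does (a ≟ b) then 1 else 0

  δ-refl : ∀ {n} (a : Fin n) → δ a a ≡ 1
  δ-refl a with a ≟ a
  ... | yes _ = refl
  ... | no a≢a = ⊥-elim (a≢a refl)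

  δ-≢ : ∀ {n} {a b : Fin n} → a ≢ b → δ a b ≡ 0
  δ-≢ {a = a} {b} a≢b with a ≟ b
  ... | yes a≡b = ⊥-elim (a≢b a≡b)
  ... | no _ = refl

  ∑ℕ-δ : ∀ {n} (t : Fin n) (g : Fin n → ℕ) → ∑ℕ (λ s → δ t s * g s) ≡ g t
  ∑ℕ-δ {suc n} zero g = trans (cong (λ x → g zero + 0 + x) (ℕΣ.sum-replicate-zero n)) (trans (ℕP.+-identityʳ _) (ℕP.+-identityʳ _))
  ∑ℕ-δ {suc n} (suc t) g = ∑ℕ-δ t (λ s → g (suc s))

  ∑ℤ-weighted-0 : ∀ {n} (F : Fin n → ℤ) → ∑ℤ (λ t → + 0 ℤ.* F t) ≡ + 0
  ∑ℤ-weighted-0 {n} F = trans (ℤΣ.sum-cong-≗ (λ t → ℤP.*-zeroˡ (F t))) (ℤΣ.sum-replicate-zero n)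

  ∑ℤ-δ : ∀ {n} (t : Fin n) (g : Fin n → ℤ) → ∑ℤ (λ s → + δ t s ℤ.* g s) ≡ g t
  ∑ℤ-δ {suc n} zero g = trans (cong₂ ℤ._+_ (ℤP.*-identityˡ (g zero)) (∑ℤ-weighted-0 (λ s → g (suc s)))) (ℤP.+-identityʳ _)
  ∑ℤ-δ {suc n} (suc t) g = trans (cong (ℤ._+ ∑ℤ (λ s → + δ t s ℤ.* g (suc s))) (ℤP.*-zeroˡ (g zero)))
                                 (trans (ℤP.+-identityˡ _) (∑ℤ-δ t (λ s → g (suc s))))

  term≤∑ℕ : ∀ {n} (f : Fin n → ℕ) i → f i ≤ ∑ℕ f
  term≤∑ℕ f zero = ℕP.m≤m+n _ _
  term≤∑ℕ f (suc i) = ℕP.≤-trans (term≤∑ℕ (λ j → f (suc j)) i) (ℕP.m≤n+m _ (f zero))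

  ∑ℕ≡0⇒≡0 : ∀ {n} (f : Fin n → ℕ) → ∑ℕ f ≡ 0 → ∀ i → f i ≡ 0
  ∑ℕ≡0⇒≡0 f ∑≡0 i = ℕP.n≤0⇒n≡0 (subst (f i ≤_) ∑≡0 (term≤∑ℕ f i))

  ∑ℕ-pos⇒∃pos : ∀ {n} (f : Fin n → ℕ) → 1 ≤ ∑ℕ f → ∃ λ i → 1 ≤ f i
  ∑ℕ-pos⇒∃pos {suc n} f 1≤∑ with f zero in f0≡
  ... | suc _ = zero , subst (1 ≤_) (sym f0≡) (s≤s z≤n)
  ... | zero with ∑ℕ-pos⇒∃pos (λ i → f (suc i)) 1≤∑
  ...   | i , 1≤fi = suc i , 1≤fi

  ∑ℤ-pos⇒∃pos : ∀ {n} (f : Fin n → ℤ) → + 1 ℤ.≤ ∑ℤ f → ∃ λ i → + 1 ℤ.≤ f i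
  ∑ℤ-pos⇒∃pos {zero} f (ℤ.+≤+ ())
  ∑ℤ-pos⇒∃pos {suc n} f 1≤∑ with + 1 ℤ.≤? f zero
  ... | yes 1≤f0 = zero , 1≤f0
  ... | no 1≰f0 with ∑ℤ-pos⇒∃pos (λ i → f (suc i)) 1≤∑rest
    where
    1≤∑rest : + 1 ℤ.≤ ∑ℤ (λ i → f (suc i))
    1≤∑rest = ℤP.≤-trans 1≤∑ (subst (∑ℤ f ℤ.≤_) (ℤP.+-identityˡ _)
                (ℤP.+-monoˡ-≤ (∑ℤ (λ i → f (suc i))) (ℤP.i<j⇒i≤pred[j] (ℤP.≰⇒> 1≰f0))))
  ...   | i , 1≤fi = suc i , 1≤fi

  ∑ℤ-neg : ∀ {n} (f : Fin n → ℤ) → ∑ℤ (λ i → ℤ.- f i) ≡ ℤ.- ∑ℤ f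
  ∑ℤ-neg {zero} f = refl
  ∑ℤ-neg {suc n} f = trans (cong (ℤ._+_ (ℤ.- f zero)) (∑ℤ-neg (λ i → f (suc i)))) (sym (ℤP.neg-distrib-+ (f zero) _))

  +-∑ℕ : ∀ {n} (f : Fin n → ℕ) → + ∑ℕ f ≡ ∑ℤ (λ i → + f i)
  +-∑ℕ {zero} f = refl
  +-∑ℕ {suc n} f = trans (ℤP.pos-+ (f zero) _) (cong (ℤ._+_ (+ f zero)) (+-∑ℕ (λ i → f (suc i))))

  ∑ℤ-↑ : ∀ {m n} (f : Fin (m + n) → ℤ) → ∑ℤ f ≡ ∑ℤ (λ i → f (i ↑ˡ n)) ℤ.+ ∑ℤ (λ j → f (m ↑ʳ j))
  ∑ℤ-↑ {zero} f = sym (ℤP.+-identityˡ _)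
  ∑ℤ-↑ {suc m} {n} f = trans (cong (ℤ._+_ (f zero)) (∑ℤ-↑ {m} {n} (λ i → f (suc i)))) (sym (ℤP.+-assoc (f zero) _ _))

  ∑ℤ-weighted-+ : ∀ {n} (F : Fin n → ℤ) (Y Y′ : Fin n → ℕ) →
    ∑ℤ (λ t → + (Y t + Y′ t) ℤ.* F t) ≡ ∑ℤ (λ t → + Y t ℤ.* F t) ℤ.+ ∑ℤ (λ t → + Y′ t ℤ.* F t)
  ∑ℤ-weighted-+ F Y Y′ = trans (ℤΣ.sum-cong-≗ (λ t → trans (cong (ℤ._* F t) (ℤP.pos-+ (Y t) (Y′ t)))
                                                            (ℤP.*-distribʳ-+ (F t) (+ Y t) (+ Y′ t))))
                               (ℤΣ.∑-distrib-+ (λ t → + Y t ℤ.* F t) (λ t → + Y′ t ℤ.* F t))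

  ∑ℤ-weighted-* : ∀ {n} (F : Fin n → ℤ) k (Y : Fin n → ℕ) →
    ∑ℤ (λ t → + (k * Y t) ℤ.* F t) ≡ + k ℤ.* ∑ℤ (λ t → + Y t ℤ.* F t)
  ∑ℤ-weighted-* F k Y = trans (ℤΣ.sum-cong-≗ (λ t → trans (cong (ℤ._* F t) (ℤP.pos-* k (Y t))) (ℤP.*-assoc (+ k) (+ Y t) (F t))))
                              (sym (ℤΣ.*-distribˡ-sum (+ k) (λ t → + Y t ℤ.* F t)))

module FourierMotzkin where
  open import Data.Nat as ℕ using (ℕ; zero; suc)
  import Data.Nat.Properties as ℕP
  open import Data.Integer as ℤ using (ℤ; +_; +[1+_]; -[1+_])
  import Data.Integer.Properties as ℤP
  open import Data.Rational using (ℚ; mkℚ; 0ℚ; _/_; _+_; _*_; _-_; _≤_; -_; 1/_; ↥_; ↧_; ↧ₙ_; *≤*)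
  import Data.Rational.Properties as ℚP
  import Data.Rational.Unnormalised as ℚᵘ
  import Data.Rational.Unnormalised.Properties as ℚᵘP
  open import Data.Rational.Solver using (module +-*-Solver)
  import Data.Nat.Coprimality as Coprime
  open import Data.Fin using (Fin; zero; suc)
  open import Data.Vec.Functional using () renaming (_∷_ to _∷ᵥ_)
  open import Data.List using (List; []; _∷_; _++_; map; cartesianProductWith)
  open import Data.List.Relation.Unary.All as All using (All; []; _∷_)
  import Data.List.Relation.Unary.All.Properties as AllP
  import Data.List.Extrema
  open import Data.List.Membership.Propositional using (_∈_)
  open import Data.List.Relation.Unary.Any using (here; there)
  open import Data.List.Membership.Propositional.Properties using (∈-cartesianProductWith⁺)
  open import Data.Product using (∃; _×_; _,_; proj₁; proj₂; uncurry)
  open import Data.Sum using (_⊎_; inj₁; inj₂)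
  open import Relation.Binary.Bundles using (DecTotalOrder)
  open import Relation.Binary.PropositionalEquality using (_≡_; setoid; refl; cong; cong₂; trans; sym; subst; subst₂; module ≡-Reasoning)

  open Sums using (∑ℤ; module ℤΣ)

  module Ext = Data.List.Extrema (DecTotalOrder.totalOrder ℚP.≤-decTotalOrder)
  open +-*-Solver using (solve; con; _:+_; _:*_; _:-_; :-_; _:=_)

  -- Unlike i / 1, this normal form lets sums and products of embedded integers compute (see ι-+ and ι-*).
  ι : ℤ → ℚ
  ι i = mkℚ i 0 (Coprime.sym (Coprime.1-coprimeTo _))

  ι≡/1 : ∀ i → i / 1 ≡ ι i
  ι≡/1 i = ℚP.↥p/↧p≡p (ι i)

  ι-0 : ι (+ 0) ≡ 0ℚ
  ι-0 = sym (ι≡/1 (+ 0))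

  ι-+ : ∀ a b → ι (a ℤ.+ b) ≡ ι a + ι b
  ι-+ a b = trans (sym (ι≡/1 _)) (cong₂ (λ x y → (x ℤ.+ y) / 1) (sym (ℤP.*-identityʳ a)) (sym (ℤP.*-identityʳ b)))

  ι-* : ∀ a b → ι (a ℤ.* b) ≡ ι a * ι b
  ι-* a b = sym (ι≡/1 _)

  ι-mono-≤ : ∀ {a b} → a ℤ.≤ b → ι a ≤ ι b
  ι-mono-≤ {a} {b} a≤b = *≤* (subst₂ ℤ._≤_ (sym (ℤP.*-identityʳ a)) (sym (ℤP.*-identityʳ b)) a≤b)

  ι-cancel-≤ : ∀ {a b} → ι a ≤ ι b → a ℤ.≤ b
  ι-cancel-≤ {a} {b} ιa≤ιb = subst₂ ℤ._≤_ (ℤP.*-identityʳ a) (ℤP.*-identityʳ b) (ℚP.drop-*≤* ιa≤ιb)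

  ι↧*≡ι↥ : ∀ x → ι (↧ x) * x ≡ ι (↥ x)
  ι↧*≡ι↥ x@(mkℚ n d _) = ℚP.toℚᵘ-injective (ℚᵘP.≃-trans (ℚP.toℚᵘ-homo-* (ι (↧ x)) x)
    (ℚᵘ.*≡* (trans (ℤP.*-identityʳ (+[1+ d ] ℤ.* n))
      (trans (ℤP.*-comm +[1+ d ] n) (cong (λ k → n ℤ.* + k) (sym (ℕP.*-identityˡ (suc d))))))))

  _·_ : ∀ {m} → (Fin m → ℤ) → (Fin m → ℚ) → ℚ
  _·_ {zero} a x = 0ℚ
  _·_ {suc m} a x = ι (a zero) * x zero + (λ j → a (suc j)) · (λ j → x (suc j))

  ·-cong : ∀ {m} a {x y : Fin m → ℚ} → (∀ j → x j ≡ y j) → a · x ≡ a · y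
  ·-cong {zero} a x≗y = refl
  ·-cong {suc m} a x≗y = cong₂ (λ u v → ι (a zero) * u + v) (x≗y zero) (·-cong (λ j → a (suc j)) (λ j → x≗y (suc j)))

  ·-linear : ∀ {m} (p q : ℤ) (r s : Fin m → ℤ) x →
    (λ j → p ℤ.* r j ℤ.+ q ℤ.* s j) · x ≡ ι p * (r · x) + ι q * (s · x)
  ·-linear {zero} p q r s x = solve 2 (λ P Q → con 0ℚ := P :* con 0ℚ :+ Q :* con 0ℚ) refl (ι p) (ι q)
  ·-linear {suc m} p q r s x = begin
    ι (p ℤ.* r zero ℤ.+ q ℤ.* s zero) * x zero + (λ j → p ℤ.* r′ j ℤ.+ q ℤ.* s′ j) · x′
      ≡⟨ cong₂ _+_ (cong (_* x zero) ι-head) (·-linear p q r′ s′ x′) ⟩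
    (ι p * ι (r zero) + ι q * ι (s zero)) * x zero + (ι p * (r′ · x′) + ι q * (s′ · x′))
      ≡⟨ solve 7 (λ P Q R₀ S₀ X₀ R S → (P :* R₀ :+ Q :* S₀) :* X₀ :+ (P :* R :+ Q :* S)
                                     := P :* (R₀ :* X₀ :+ R) :+ Q :* (S₀ :* X₀ :+ S)) refl
                 (ι p) (ι q) (ι (r zero)) (ι (s zero)) (x zero) (r′ · x′) (s′ · x′) ⟩
    ι p * (r · x) + ι q * (s · x) ∎
    where
    open ≡-Reasoning
    r′ s′ : Fin m → ℤ
    r′ j = r (suc j)
    s′ j = s (suc j)
    x′ : Fin m → ℚ
    x′ j = x (suc j)
    ι-head : ι (p ℤ.* r zero ℤ.+ q ℤ.* s zero) ≡ ι p * ι (r zero) + ι q * ι (s zero)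
    ι-head = trans (ι-+ (p ℤ.* r zero) (q ℤ.* s zero)) (cong₂ _+_ (ι-* p (r zero)) (ι-* q (s zero)))

  *1/ι-cancelʳ : ∀ k q → q * 1/ ι +[1+ k ] * ι +[1+ k ] ≡ q
  *1/ι-cancelʳ k q = trans (ℚP.*-assoc q _ _) (trans (cong (q *_) (ℚP.*-inverseˡ (ι +[1+ k ]))) (ℚP.*-identityʳ q))

  lowerBound-sound : ∀ k (β s x : ℚ) → (β - s) * 1/ ι +[1+ k ] ≤ x → β ≤ ι +[1+ k ] * x + s
  lowerBound-sound k β s x bound≤x = subst₂ _≤_ (solve 2 (λ β s → β :- s :+ s := β) refl β s)
    (solve 3 (λ x a s → x :* a :+ s := a :* x :+ s) refl x a s)
    (ℚP.+-monoˡ-≤ s (subst (_≤ x * a) (*1/ι-cancelʳ k (β - s)) (ℚP.*-monoʳ-≤-nonNeg a bound≤x)))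
    where
    a : ℚ
    a = ι +[1+ k ]

  upperBound-sound : ∀ k (β s x : ℚ) → x ≤ (s - β) * 1/ ι +[1+ k ] → β ≤ ι -[1+ k ] * x + s
  upperBound-sound k β s x x≤bound = subst₂ _≤_ (solve 3 (λ x a β → x :* a :+ (β :- x :* a) := β) refl x a β)
    (solve 4 (λ s β x a → s :- β :+ (β :- x :* a) := (:- a) :* x :+ s) refl s β x a)
    (ℚP.+-monoˡ-≤ (β - x * a) (subst (x * a ≤_) (*1/ι-cancelʳ k (s - β)) (ℚP.*-monoʳ-≤-nonNeg a x≤bound)))
    where
    a : ℚ
    a = ι +[1+ k ]

  bounds-compatible : ∀ kₗ kᵤ (βₗ βᵤ sₗ sᵤ : ℚ) →
    ι +[1+ kᵤ ] * βₗ + ι +[1+ kₗ ] * βᵤ ≤ ι +[1+ kᵤ ] * sₗ + ι +[1+ kₗ ] * sᵤ →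
    (βₗ - sₗ) * 1/ ι +[1+ kₗ ] ≤ (sᵤ - βᵤ) * 1/ ι +[1+ kᵤ ]
  bounds-compatible kₗ kᵤ βₗ βᵤ sₗ sᵤ combined = ℚP.*-cancelʳ-≤-pos a
    (subst₂ _≤_ (sym (*1/ι-cancelʳ kₗ X)) refl
      (ℚP.*-cancelʳ-≤-pos b (subst₂ _≤_ refl (sym Yb⁻¹ab≡Ya) Xb≤Ya)))
    where
    a b X Y : ℚ
    a = ι +[1+ kₗ ]
    b = ι +[1+ kᵤ ]
    X = βₗ - sₗ
    Y = sᵤ - βᵤ
    Xb≤Ya : X * b ≤ Y * a
    Xb≤Ya = subst₂ _≤_
      (solve 6 (λ a b βₗ sₗ βᵤ sᵤ → b :* βₗ :+ a :* βᵤ :+ (:- (b :* sₗ :+ a :* βᵤ)) := (βₗ :- sₗ) :* b)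
               refl a b βₗ sₗ βᵤ sᵤ)
      (solve 6 (λ a b βₗ sₗ βᵤ sᵤ → b :* sₗ :+ a :* sᵤ :+ (:- (b :* sₗ :+ a :* βᵤ)) := (sᵤ :- βᵤ) :* a)
               refl a b βₗ sₗ βᵤ sᵤ)
      (ℚP.+-monoˡ-≤ (- (b * sₗ + a * βᵤ)) combined)
    Yb⁻¹ab≡Ya : Y * 1/ b * a * b ≡ Y * a
    Yb⁻¹ab≡Ya = trans (solve 4 (λ Y b⁻¹ a b → Y :* b⁻¹ :* a :* b := Y :* b⁻¹ :* b :* a) refl Y (1/ b) a b)
                      (cong (_* a) (*1/ι-cancelʳ kᵤ Y))

  separatingPoint : ∀ {A B : Set} (l : A → ℚ) (u : B → ℚ) (as : List A) (bs : List B) →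
    (∀ {a b} → a ∈ as → b ∈ bs → l a ≤ u b) →
    ∃ λ x → All (λ a → l a ≤ x) as × All (λ b → x ≤ u b) bs
  separatingPoint l u [] bs _ = Ext.min 0ℚ (map u bs) , [] , AllP.map⁻ (Ext.min≤xs 0ℚ (map u bs))
  separatingPoint l u (a ∷ as) bs l≤u =
    Ext.max (l a) (map l as) ,
    Ext.v≤max⁺ (l a) (map l as) (inj₁ ℚP.≤-refl) ∷ AllP.map⁻ (Ext.xs≤max (l a) (map l as)) ,
    All.tabulate (λ b∈ → Ext.max≤v⁺ (l≤u (here refl) b∈) (AllP.map⁺ (All.tabulate (λ a∈ → l≤u (there a∈) b∈))))

  Row : ℕ → Set
  Row m = (Fin m → ℤ) × ℤ

  -- (a , β) stands for the inequality β ≤ a · x.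
  _⊨_ : ∀ {m} → (Fin m → ℚ) → Row m → Set
  x ⊨ (a , β) = ι β ≤ a · x

  record ConicallyClosed {m} (D : (Fin m → ℤ) → ℤ → Set) : Set where
    field
      resp  : ∀ {a b β} → (∀ j → a j ≡ b j) → D a β → D b β
      add   : ∀ {a b α β} → D a α → D b β → D (λ j → a j ℤ.+ b j) (α ℤ.+ β)
      scale : ∀ k {a β} → D a β → D (λ j → +[1+ k ] ℤ.* a j) (+[1+ k ] ℤ.* β)

  -- D derives 1 + k ≤ 0 · x.
  Contradiction : ∀ {m} → ((Fin m → ℤ) → ℤ → Set) → Set
  Contradiction D = ∃ λ k → D (λ _ → + 0) +[1+ k ]

  module Elimination {m : ℕ} where

    -- (k , r) is a row whose eliminated coefficient is ±(1 + k) and whose other part is r.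
    Bound : Set
    Bound = ℕ × Row m

    tail : Row (suc m) → Row m
    tail (a , β) = (λ j → a (suc j)) , β

    pushLower : ℤ → Row m → List Bound → List Bound
    pushLower +[1+ k ] r bs = (k , r) ∷ bs
    pushLower _        r bs = bs

    pushUpper : ℤ → Row m → List Bound → List Bound
    pushUpper -[1+ k ] r bs = (k , r) ∷ bs
    pushUpper _        r bs = bs

    pushFree : ℤ → Row m → List (Row m) → List (Row m)
    pushFree (+ 0) r rs = r ∷ rs
    pushFree _     r rs = rs

    lowers uppers : List (Row (suc m)) → List Bound
    lowers [] = []
    lowers (r ∷ rs) = pushLower (proj₁ r zero) (tail r) (lowers rs)
    uppers [] = []
    uppers (r ∷ rs) = pushUpper (proj₁ r zero) (tail r) (uppers rs)

    frees : List (Row (suc m)) → List (Row m)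
    frees [] = []
    frees (r ∷ rs) = pushFree (proj₁ r zero) (tail r) (frees rs)

    combine : Bound → Bound → Row m
    combine (kₗ , aₗ , βₗ) (kᵤ , aᵤ , βᵤ) =
      (λ j → +[1+ kᵤ ] ℤ.* aₗ j ℤ.+ +[1+ kₗ ] ℤ.* aᵤ j) , (+[1+ kᵤ ] ℤ.* βₗ ℤ.+ +[1+ kₗ ] ℤ.* βᵤ)

    project : List (Row (suc m)) → List (Row m)
    project rs = frees rs ++ cartesianProductWith combine (lowers rs) (uppers rs)

    module Derivations (D : (Fin (suc m) → ℤ) → ℤ → Set) (closed : ConicallyClosed D) where
      open ConicallyClosed closed

      D₀ : (Fin m → ℤ) → ℤ → Set
      D₀ a β = D (+ 0 ∷ᵥ a) β

      closed₀ : ConicallyClosed D₀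
      closed₀ = record
        { resp  = λ a≗b → resp (λ { zero → refl ; (suc j) → a≗b j })
        ; add   = λ d e → resp (λ { zero → refl ; (suc j) → refl }) (add d e)
        ; scale = λ k d → resp (λ { zero → ℤP.*-zeroʳ +[1+ k ] ; (suc j) → refl }) (scale k d) }

      DLower DUpper : Bound → Set
      DLower (k , a , β) = D (+[1+ k ] ∷ᵥ a) β
      DUpper (k , a , β) = D (-[1+ k ] ∷ᵥ a) β

      push-derivable : ∀ c (r : Row m) {ls us fs} → D (c ∷ᵥ proj₁ r) (proj₂ r) →
        All DLower ls → All DUpper us → All (uncurry D₀) fs →
        All DLower (pushLower c r ls) × All DUpper (pushUpper c r us) × All (uncurry D₀) (pushFree c r fs)
      push-derivable (+ 0)    r d ls us fs = ls , us , d ∷ fs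
      push-derivable +[1+ k ] r d ls us fs = d ∷ ls , us , fs
      push-derivable -[1+ k ] r d ls us fs = ls , d ∷ us , fs

      split-derivable : ∀ rs → All (uncurry D) rs →
        All DLower (lowers rs) × All DUpper (uppers rs) × All (uncurry D₀) (frees rs)
      split-derivable [] [] = [] , [] , []
      split-derivable ((a , β) ∷ rs) (d ∷ ds) =
        let ls , us , fs = split-derivable rs ds in
        push-derivable (a zero) (tail (a , β)) (resp (λ { zero → refl ; (suc j) → refl }) d) ls us fs

      cancels : ∀ kₗ kᵤ → +[1+ kᵤ ] ℤ.* +[1+ kₗ ] ℤ.+ +[1+ kₗ ] ℤ.* -[1+ kᵤ ] ≡ + 0
      cancels kₗ kᵤ = trans (cong (ℤ._+ (+[1+ kₗ ] ℤ.* -[1+ kᵤ ])) (ℤP.*-comm +[1+ kᵤ ] +[1+ kₗ ]))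
        (trans (sym (ℤP.*-distribˡ-+ +[1+ kₗ ] +[1+ kᵤ ] -[1+ kᵤ ]))
          (trans (cong (+[1+ kₗ ] ℤ.*_) (ℤP.+-inverseʳ +[1+ kᵤ ])) (ℤP.*-zeroʳ +[1+ kₗ ])))

      combine-derivable : ∀ l u → DLower l → DUpper u → uncurry D₀ (combine l u)
      combine-derivable (kₗ , _) (kᵤ , _) dₗ dᵤ =
        resp (λ { zero → cancels kₗ kᵤ ; (suc j) → refl }) (add (scale kᵤ dₗ) (scale kₗ dᵤ))

      project-derivable : ∀ rs → All (uncurry D) rs → All (uncurry D₀) (project rs)
      project-derivable rs ds =
        let ls , us , fs = split-derivable rs ds in
        AllP.++⁺ fs (AllP.cartesianProductWith⁺ (setoid Bound) (setoid Bound) combine (lowers rs) (uppers rs)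
          (λ l∈ u∈ → combine-derivable _ _ (All.lookup ls l∈) (All.lookup us u∈)))

    module Lifting (x₀ : ℚ) (x : Fin m → ℚ) where

      SatLower SatUpper : Bound → Set
      SatLower (k , a , β) = ι β ≤ ι +[1+ k ] * x₀ + a · x
      SatUpper (k , a , β) = ι β ≤ ι -[1+ k ] * x₀ + a · x

      pop-satisfied : ∀ c a β {ls us fs} → All SatLower (pushLower c (a , β) ls) →
        All SatUpper (pushUpper c (a , β) us) → All (x ⊨_) (pushFree c (a , β) fs) →
        (ι β ≤ ι c * x₀ + a · x) × All SatLower ls × All SatUpper us × All (x ⊨_) fs
      pop-satisfied (+ 0) a β ls us (f ∷ fs) =
        subst (ι β ≤_) (sym (trans (cong (_+ a · x) (trans (cong (_* x₀) ι-0) (ℚP.*-zeroˡ x₀))) (ℚP.+-identityˡ _))) f , ls , us , fs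
      pop-satisfied +[1+ k ] a β (l ∷ ls) us fs = l , ls , us , fs
      pop-satisfied -[1+ k ] a β ls (u ∷ us) fs = u , ls , us , fs

      lift-satisfied : ∀ rs → All SatLower (lowers rs) → All SatUpper (uppers rs) → All (x ⊨_) (frees rs) →
        All ((x₀ ∷ᵥ x) ⊨_) rs
      lift-satisfied [] _ _ _ = []
      lift-satisfied ((a , β) ∷ rs) ls us fs =
        let s , ls′ , us′ , fs′ = pop-satisfied (a zero) (λ j → a (suc j)) β ls us fs in
        s ∷ lift-satisfied rs ls′ us′ fs′

  -- Eliminating x₀ pairs every lower bound on x₀ with every upper bound; a solution of the projected
  -- system puts each lower bound below each upper bound, so it extends to a solution with some x₀.
  fourierMotzkin : ∀ m (D : (Fin m → ℤ) → ℤ → Set) → ConicallyClosed D → ∀ rows → All (uncurry D) rows →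
    (∃ λ x → All (x ⊨_) rows) ⊎ Contradiction D
  fourierMotzkin zero D closed = noVariables
    where
    open ConicallyClosed closed
    noVariables : ∀ rows → All (uncurry D) rows → (∃ λ x → All (x ⊨_) rows) ⊎ Contradiction D
    noVariables [] [] = inj₁ ((λ ()) , [])
    noVariables ((a , +[1+ k ]) ∷ rs) (d ∷ ds) = inj₂ (k , resp (λ ()) d)
    noVariables ((a , + 0) ∷ rs) (d ∷ ds) with noVariables rs ds
    ... | inj₂ c = inj₂ c
    ... | inj₁ (x , sat) = inj₁ (x , subst (ι (+ 0) ≤_) ι-0 ℚP.≤-refl ∷ sat)
    noVariables ((a , -[1+ k ]) ∷ rs) (d ∷ ds) with noVariables rs ds
    ... | inj₂ c = inj₂ c
    ... | inj₁ (x , sat) = inj₁ (x , subst (ι -[1+ k ] ≤_) ι-0 (ι-mono-≤ ℤ.-≤+) ∷ sat)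
  fourierMotzkin (suc m) D closed rows ds
    with fourierMotzkin m D₀ closed₀ (project rows) (project-derivable rows ds)
    where open Elimination {m}
          open Derivations D closed
  ... | inj₂ (k , d) = inj₂ (k , ConicallyClosed.resp closed (λ { zero → refl ; (suc j) → refl }) d)
  ... | inj₁ (x , sat) =
    let x₀ , l≤x₀ , x₀≤u = separatingPoint lower upper (lowers rows) (uppers rows) compatible in
    inj₁ (x₀ ∷ᵥ x , lift-satisfied x₀ x rows (All.map (λ {l} → lowerBound-sound′ x₀ l) l≤x₀)
                                          (All.map (λ {u} → upperBound-sound′ x₀ u) x₀≤u) sat-frees)
    where
    open Elimination {m}
    open Lifting
    sat-frees : All (x ⊨_) (frees rows)
    sat-frees = AllP.++⁻ˡ (frees rows) sat
    sat-combined : All (x ⊨_) (cartesianProductWith combine (lowers rows) (uppers rows))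
    sat-combined = AllP.++⁻ʳ (frees rows) sat
    lower upper : Bound → ℚ
    lower (k , a , β) = (ι β - a · x) * 1/ ι +[1+ k ]
    upper (k , a , β) = (a · x - ι β) * 1/ ι +[1+ k ]
    compatible : ∀ {l u} → l ∈ lowers rows → u ∈ uppers rows → lower l ≤ upper u
    compatible {kₗ , aₗ , βₗ} {kᵤ , aᵤ , βᵤ} l∈ u∈ =
      bounds-compatible kₗ kᵤ (ι βₗ) (ι βᵤ) (aₗ · x) (aᵤ · x)
        (subst₂ _≤_ (trans (ι-+ (+[1+ kᵤ ] ℤ.* βₗ) (+[1+ kₗ ] ℤ.* βᵤ))
                           (cong₂ _+_ (ι-* +[1+ kᵤ ] βₗ) (ι-* +[1+ kₗ ] βᵤ)))
                    (·-linear +[1+ kᵤ ] +[1+ kₗ ] aₗ aᵤ x)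
                    (All.lookup sat-combined (∈-cartesianProductWith⁺ combine l∈ u∈)))
    lowerBound-sound′ : ∀ x₀ l → lower l ≤ x₀ → SatLower x₀ x l
    lowerBound-sound′ x₀ (k , a , β) = lowerBound-sound k (ι β) (a · x) x₀
    upperBound-sound′ : ∀ x₀ u → x₀ ≤ upper u → SatUpper x₀ x u
    upperBound-sound′ x₀ (k , a , β) = upperBound-sound k (ι β) (a · x) x₀

  _·ℤ_ : ∀ {m} → (Fin m → ℤ) → (Fin m → ℤ) → ℤ
  a ·ℤ n = ∑ℤ (λ j → a j ℤ.* n j)

  _⊨ℤ_ : ∀ {m} → (Fin m → ℤ) → Row m → Set
  n ⊨ℤ (a , β) = β ℤ.≤ a ·ℤ n

  ·-ι : ∀ {m} a (n : Fin m → ℤ) → a · (λ j → ι (n j)) ≡ ι (a ·ℤ n)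
  ·-ι {zero} a n = sym ι-0
  ·-ι {suc m} a n = trans (cong₂ _+_ (sym (ι-* (a zero) (n zero))) (·-ι (λ j → a (suc j)) (λ j → n (suc j))))
                          (sym (ι-+ (a zero ℤ.* n zero) ((λ j → a (suc j)) ·ℤ (λ j → n (suc j)))))

  ·-scale : ∀ {m} a (c : ℚ) (x : Fin m → ℚ) → a · (λ j → c * x j) ≡ c * (a · x)
  ·-scale {zero} a c x = sym (ℚP.*-zeroʳ c)
  ·-scale {suc m} a c x = trans (cong (_+_ (ι (a zero) * (c * x zero))) (·-scale (λ j → a (suc j)) c (λ j → x (suc j))))
    (solve 4 (λ A C X R → A :* (C :* X) :+ C :* R := C :* (A :* X :+ R))
             refl (ι (a zero)) c (x zero) ((λ j → a (suc j)) · (λ j → x (suc j))))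

  clearDenominators : ∀ {m} (x : Fin m → ℚ) → ∃ λ K → ∃ λ (n : Fin m → ℤ) → ∀ j → ι +[1+ K ] * x j ≡ ι (n j)
  clearDenominators {zero} x = 0 , (λ ()) , (λ ())
  clearDenominators {suc m} x =
    let K , n , Kx≡n = clearDenominators (λ j → x (suc j)) in
    ℕ.pred (↧ₙ x₀ ℕ.* suc K) , (+[1+ K ] ℤ.* ↥ x₀) ∷ᵥ (λ j → ↧ x₀ ℤ.* n j) , λ
      { zero → head≡ K
      ; (suc j) → trans (cong (_* x (suc j)) (ι-scale K)) (trans (ℚP.*-assoc (ι (↧ x₀)) (ι +[1+ K ]) (x (suc j)))
                    (trans (cong (ι (↧ x₀) *_) (Kx≡n j)) (sym (ι-* (↧ x₀) (n j))))) }
    where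
    x₀ : ℚ
    x₀ = x zero
    ι-scale : ∀ K → ι +[1+ ℕ.pred (↧ₙ x₀ ℕ.* suc K) ] ≡ ι (↧ x₀) * ι +[1+ K ]
    ι-scale K with x₀
    ... | mkℚ _ d _ = trans (cong ι (sym (ℤP.pos-* (suc d) (suc K)))) (ι-* (+ suc d) (+ suc K))
    head≡ : ∀ K → ι +[1+ ℕ.pred (↧ₙ x₀ ℕ.* suc K) ] * x₀ ≡ ι (+[1+ K ] ℤ.* ↥ x₀)
    head≡ K = trans (cong (_* x₀) (trans (ι-scale K) (ℚP.*-comm (ι (↧ x₀)) (ι +[1+ K ]))))
      (trans (ℚP.*-assoc (ι +[1+ K ]) (ι (↧ x₀)) x₀)
        (trans (cong (ι +[1+ K ] *_) (ι↧*≡ι↥ x₀)) (sym (ι-* +[1+ K ] (↥ x₀)))))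

  -- Scaling a rational solution by a common denominator is again a solution, because
  -- the right-hand sides are non-negative.
  fourierMotzkinℤ : ∀ m (D : (Fin m → ℤ) → ℤ → Set) → ConicallyClosed D → ∀ rows → All (uncurry D) rows →
    All (λ r → + 0 ℤ.≤ proj₂ r) rows → (∃ λ n → All (n ⊨ℤ_) rows) ⊎ Contradiction D
  fourierMotzkinℤ m D closed rows ds nonNeg with fourierMotzkin m D closed rows ds
  ... | inj₂ c = inj₂ c
  ... | inj₁ (x , sat) =
    let K , n , Kx≡n = clearDenominators x in
    inj₁ (n , All.zipWith (λ { {a , + β} (x⊨r , _) → integral K n Kx≡n a β x⊨r ; {_ , -[1+ _ ]} (_ , ()) }) (sat , nonNeg))
    where
    integral : ∀ K n → (∀ j → ι +[1+ K ] * x j ≡ ι (n j)) → ∀ a β → x ⊨ (a , + β) → n ⊨ℤ (a , + β)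
    integral K n Kx≡n a β x⊨r = ℤP.≤-trans (ℤ.+≤+ (ℕP.m≤m+n β (K ℕ.* β)))
      (ι-cancel-≤ (subst₂ _≤_ (sym (trans (cong ι (ℤP.pos-* (suc K) β)) (ι-* +[1+ K ] (+ β))))
                              (trans (sym (·-scale a (ι +[1+ K ]) x)) (trans (·-cong a Kx≡n) (·-ι a n)))
                              (ℚP.*-monoˡ-≤-nonNeg (ι +[1+ K ]) x⊨r)))

  ·ℤ-∑ : ∀ {k m} (a : Fin k → ℤ) (F : Fin k → Fin m → ℤ) n →
    (λ j → ∑ℤ (λ t → a t ℤ.* F t j)) ·ℤ n ≡ ∑ℤ (λ t → a t ℤ.* (F t ·ℤ n))
  ·ℤ-∑ a F n = begin
    ∑ℤ (λ j → ∑ℤ (λ t → a t ℤ.* F t j) ℤ.* n j)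
      ≡⟨ ℤΣ.sum-cong-≗ (λ j → ℤΣ.*-distribʳ-sum (n j) (λ t → a t ℤ.* F t j)) ⟩
    ∑ℤ (λ j → ∑ℤ (λ t → a t ℤ.* F t j ℤ.* n j))
      ≡⟨ ℤΣ.∑-comm (λ j t → a t ℤ.* F t j ℤ.* n j) ⟩
    ∑ℤ (λ t → ∑ℤ (λ j → a t ℤ.* F t j ℤ.* n j))
      ≡⟨ ℤΣ.sum-cong-≗ (λ t → ℤΣ.sum-cong-≗ (λ j → ℤP.*-assoc (a t) (F t j) (n j))) ⟩
    ∑ℤ (λ t → ∑ℤ (λ j → a t ℤ.* (F t j ℤ.* n j)))
      ≡⟨ ℤΣ.sum-cong-≗ (λ t → ℤΣ.*-distribˡ-sum (a t) (λ j → F t j ℤ.* n j)) ⟨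
    ∑ℤ (λ t → a t ℤ.* (F t ·ℤ n)) ∎
    where open ≡-Reasoning

open import Defs
open import Data.Nat as ℕ using (ℕ)
open import Data.Fin using (Fin)

module Walks {d : ℕ} (A : VASS d) where
  open import Data.Nat as ℕ using (zero; suc; _+_; _*_; _≤_; _∸_; z≤n; s≤s)
  import Data.Nat.Properties as ℕP
  open import Data.Fin using (Fin; zero; suc)
  open import Data.Fin.Properties using (_≟_)
  open import Data.List using (List; []; _∷_; _++_; length; concat; tabulate)
  open import Data.List.Relation.Unary.All using (All; []; _∷_)
  open import Data.Product using (∃; ∃₂; _×_; _,_)
  open import Data.Empty using (⊥-elim)
  open import Relation.Nullary using (yes; no; ¬_)
  open import Relation.Binary.PropositionalEquality using (_≡_; _≢_; refl; cong; cong₂; trans; sym; subst; module ≡-Reasoning)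
  open Sums
  import Algebra.Properties.CommutativeSemigroup as CommSemigroupProps

  module +-CS = CommSemigroupProps ℕP.+-commutativeSemigroup

  T : Set
  T = Fin (nT A)

  Q : Set
  Q = Fin (nQ A)

  data Walk : Q → Q → List T → Set where
    nil  : ∀ {p} → Walk p p []
    cons : ∀ {p q} t {ts} → src A t ≡ p → Walk (tgt A t) q ts → Walk p q (t ∷ ts)

  walk-++ : ∀ {p q r xs ys} → Walk p q xs → Walk q r ys → Walk p r (xs ++ ys)
  walk-++ nil w = w
  walk-++ (cons t e w₁) w = cons t e (walk-++ w₁ w)

  count : List T → T → ℕ
  count [] t = 0
  count (s ∷ ts) t = δ s t + count ts t

  count-++ : ∀ xs ys t → count (xs ++ ys) t ≡ count xs t + count ys t
  count-++ [] ys t = refl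
  count-++ (x ∷ xs) ys t = trans (cong (δ x t +_) (count-++ xs ys t)) (sym (ℕP.+-assoc (δ x t) _ _))

  flow : (T → Q) → (T → ℕ) → Q → ℕ
  flow e X r = ∑ℕ (λ t → δ (e t) r * X t)

  inflow outflow : (T → ℕ) → Q → ℕ
  inflow = flow (tgt A)
  outflow = flow (src A)

  Circulation : (T → ℕ) → Set
  Circulation X = ∀ r → inflow X r ≡ outflow X r

  FlowFrom_To_ : Q → Q → (T → ℕ) → Set
  (FlowFrom v To q) X = ∀ r → inflow X r + δ v r ≡ outflow X r + δ q r

  flow-cong : ∀ e {X Y} r → (∀ t → X t ≡ Y t) → flow e X r ≡ flow e Y r
  flow-cong e r X≗Y = ℕΣ.sum-cong-≗ (λ t → cong (δ (e _) r *_) (X≗Y t))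

  flow-+ : ∀ e X Y r → flow e (λ t → X t + Y t) r ≡ flow e X r + flow e Y r
  flow-+ e X Y r = trans (ℕΣ.sum-cong-≗ (λ t → ℕP.*-distribˡ-+ (δ (e t) r) (X t) (Y t)))
                         (ℕΣ.∑-distrib-+ (λ t → δ (e t) r * X t) (λ t → δ (e t) r * Y t))

  flow-δ : ∀ e t₀ r → flow e (δ t₀) r ≡ δ (e t₀) r
  flow-δ e t₀ r = trans (ℕΣ.sum-cong-≗ (λ t → ℕP.*-comm (δ (e t) r) (δ t₀ t))) (∑ℕ-δ t₀ (λ t → δ (e t) r))

  flow-zero : ∀ e r → flow e (λ _ → 0) r ≡ 0
  flow-zero e r = trans (ℕΣ.sum-cong-≗ (λ t → ℕP.*-zeroʳ (δ (e t) r))) (ℕΣ.sum-replicate-zero (nT A))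

  flow-+δ : ∀ e {X X′} t₀ → (∀ s → X′ s + δ t₀ s ≡ X s) → ∀ r → flow e X r ≡ flow e X′ r + δ (e t₀) r
  flow-+δ e {X} {X′} t₀ X′+δ≡X r =
    trans (sym (flow-cong e r X′+δ≡X)) (trans (flow-+ e X′ (δ t₀) r) (cong (flow e X′ r +_) (flow-δ e t₀ r)))

  flow-count-∷ : ∀ e t ts r → flow e (count (t ∷ ts)) r ≡ δ (e t) r + flow e (count ts) r
  flow-count-∷ e t ts r = trans (flow-+ e (δ t) (count ts) r) (cong (_+ flow e (count ts) r) (flow-δ e t r))

  walk-flow : ∀ {p q W} → Walk p q W → (FlowFrom p To q) (count W)
  walk-flow {p} nil r = cong (_+ δ p r) (trans (flow-zero (tgt A) r) (sym (flow-zero (src A) r)))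
  walk-flow {q = q} (cons t {ts} refl w) r = begin
    inflow (count (t ∷ ts)) r + δ (src A t) r
      ≡⟨ cong (_+ δ (src A t) r) (flow-count-∷ (tgt A) t ts r) ⟩
    δ (tgt A t) r + inflow (count ts) r + δ (src A t) r
      ≡⟨ cong (_+ δ (src A t) r) (ℕP.+-comm (δ (tgt A t) r) _) ⟩
    inflow (count ts) r + δ (tgt A t) r + δ (src A t) r
      ≡⟨ cong (_+ δ (src A t) r) (walk-flow w r) ⟩
    outflow (count ts) r + δ q r + δ (src A t) r
      ≡⟨ +-CS.xy∙z≈zx∙y (outflow (count ts) r) (δ q r) (δ (src A t) r) ⟩
    δ (src A t) r + outflow (count ts) r + δ q r
      ≡⟨ cong (_+ δ q r) (flow-count-∷ (src A) t ts r) ⟨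
    outflow (count (t ∷ ts)) r + δ q r ∎
    where open ≡-Reasoning

  flow-pos⇒∃ : ∀ e X r → 1 ≤ flow e X r → ∃ λ t → e t ≡ r × 1 ≤ X t
  flow-pos⇒∃ e X r 1≤flow = let t , 1≤δX = ∑ℕ-pos⇒∃pos _ 1≤flow in t , split t 1≤δX
    where
    split : ∀ t → 1 ≤ δ (e t) r * X t → e t ≡ r × 1 ≤ X t
    split t 1≤δX with e t ≟ r
    ... | yes et≡r = et≡r , subst (1 ≤_) (ℕP.+-identityʳ (X t)) 1≤δX
    ... | no _ with 1≤δX
    ... | ()

  _-δ_ : (T → ℕ) → T → T → ℕ
  (X -δ t) s = X s ∸ δ t s

  -δ+δ : ∀ X {t} → 1 ≤ X t → ∀ s → (X -δ t) s + δ t s ≡ X s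
  -δ+δ X {t} 1≤Xt s = ℕP.m∸n+n≡m (δ≤X s)
    where
    δ≤X : ∀ s → δ t s ≤ X s
    δ≤X s with t ≟ s
    ... | yes refl = 1≤Xt
    ... | no _ = z≤n

  ∑-δ : ∀ X {t} → 1 ≤ X t → suc (∑ℕ (X -δ t)) ≡ ∑ℕ X
  ∑-δ X {t} 1≤Xt = begin
    suc (∑ℕ (X -δ t))                      ≡⟨ ℕP.+-comm 1 _ ⟩
    ∑ℕ (X -δ t) + 1                        ≡⟨ cong (∑ℕ (X -δ t) +_) (∑ℕ-δ t (λ _ → 1)) ⟨
    ∑ℕ (X -δ t) + ∑ℕ (λ s → δ t s * 1)     ≡⟨ cong (∑ℕ (X -δ t) +_) (ℕΣ.sum-cong-≗ (λ s → ℕP.*-identityʳ (δ t s))) ⟩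
    ∑ℕ (X -δ t) + ∑ℕ (δ t)                 ≡⟨ ℕΣ.∑-distrib-+ (X -δ t) (δ t) ⟨
    ∑ℕ (λ s → (X -δ t) s + δ t s)          ≡⟨ ℕΣ.sum-cong-≗ (-δ+δ X 1≤Xt) ⟩
    ∑ℕ X ∎
    where open ≡-Reasoning

  flowFrom⇒outflow-pos : ∀ {v q} X → v ≢ q → (FlowFrom v To q) X → 1 ≤ outflow X v
  flowFrom⇒outflow-pos {v} {q} X v≢q X-flow = subst (1 ≤_) (begin
    inflow X v + 1          ≡⟨ cong (inflow X v +_) (δ-refl v) ⟨
    inflow X v + δ v v      ≡⟨ X-flow v ⟩
    outflow X v + δ q v     ≡⟨ cong (outflow X v +_) (δ-≢ (λ q≡v → v≢q (sym q≡v))) ⟩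
    outflow X v + 0         ≡⟨ ℕP.+-identityʳ _ ⟩
    outflow X v ∎) (ℕP.m≤n+m 1 (inflow X v))
    where open ≡-Reasoning

  flowFrom-step : ∀ {v q} X {t} → (FlowFrom v To q) X → src A t ≡ v → 1 ≤ X t → (FlowFrom tgt A t To q) (X -δ t)
  flowFrom-step {v} {q} X {t} X-flow src≡v 1≤Xt r = ℕP.+-cancelʳ-≡ (δ v r) _ _ (begin
    inflow (X -δ t) r + δ (tgt A t) r + δ v r   ≡⟨ cong (_+ δ v r) (flow-+δ (tgt A) t (-δ+δ X 1≤Xt) r) ⟨
    inflow X r + δ v r                          ≡⟨ X-flow r ⟩
    outflow X r + δ q r                         ≡⟨ cong (_+ δ q r) (flow-+δ (src A) t (-δ+δ X 1≤Xt) r) ⟩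
    outflow (X -δ t) r + δ (src A t) r + δ q r  ≡⟨ cong (λ p → outflow (X -δ t) r + δ p r + δ q r) src≡v ⟩
    outflow (X -δ t) r + δ v r + δ q r          ≡⟨ +-CS.xy∙z≈xz∙y (outflow (X -δ t) r) (δ v r) (δ q r) ⟩
    outflow (X -δ t) r + δ q r + δ v r ∎)
    where open ≡-Reasoning

  count-∷ : ∀ X {t} {W : List T} {X′ : T → ℕ} → 1 ≤ X t →
    (∀ s → count W s + X′ s ≡ (X -δ t) s) → ∀ s → count (t ∷ W) s + X′ s ≡ X s
  count-∷ X {t} {W} {X′} 1≤Xt W+X′≡X₁ s = begin
    δ t s + count W s + X′ s     ≡⟨ ℕP.+-assoc (δ t s) _ _ ⟩
    δ t s + (count W s + X′ s)   ≡⟨ cong (δ t s +_) (W+X′≡X₁ s) ⟩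
    δ t s + (X -δ t) s           ≡⟨ ℕP.+-comm (δ t s) _ ⟩
    (X -δ t) s + δ t s           ≡⟨ -δ+δ X 1≤Xt s ⟩
    X s ∎
    where open ≡-Reasoning

  -- Follow X from v, using up one unit of X per step, until q is reached.
  walkAlong : ∀ n X {v q} → ∑ℕ X ≡ n → (FlowFrom v To q) X →
    ∃₂ λ W X′ → Walk v q W × (∀ t → count W t + X′ t ≡ X t) × Circulation X′
  walkAlong n X {v} {q} ∑X≡n X-flow with v ≟ q
  ... | yes refl = [] , X , nil , (λ t → refl) , (λ r → ℕP.+-cancelʳ-≡ (δ v r) _ _ (X-flow r))
  ... | no v≢q with flow-pos⇒∃ (src A) X v (flowFrom⇒outflow-pos X v≢q X-flow)
  walkAlong zero X ∑X≡0 X-flow | no _ | t , _ , 1≤Xt =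
    ⊥-elim (ℕP.<⇒≢ (ℕP.≤-trans 1≤Xt (term≤∑ℕ X t)) (sym ∑X≡0))
  walkAlong (suc n) X {q = q} ∑X≡n X-flow | no _ | t , src≡v , 1≤Xt
    with walkAlong n (X -δ t) (ℕP.suc-injective (trans (∑-δ X 1≤Xt) ∑X≡n)) (flowFrom-step {q = q} X X-flow src≡v 1≤Xt)
  ... | W , X′ , w , W+X′≡X₁ , X′-circ = t ∷ W , X′ , cons t src≡v w , count-∷ X {W = W} 1≤Xt W+X′≡X₁ , X′-circ

  circulation-step : ∀ X {t} → Circulation X → 1 ≤ X t → (FlowFrom tgt A t To src A t) (X -δ t)
  circulation-step X {t} X-circ 1≤Xt r = begin
    inflow (X -δ t) r + δ (tgt A t) r    ≡⟨ flow-+δ (tgt A) t (-δ+δ X 1≤Xt) r ⟨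
    inflow X r                           ≡⟨ X-circ r ⟩
    outflow X r                          ≡⟨ flow-+δ (src A) t (-δ+δ X 1≤Xt) r ⟩
    outflow (X -δ t) r + δ (src A t) r ∎
    where open ≡-Reasoning

  addAt : Q → List T → (Q → List T) → Q → List T
  addAt q C L r with q ≟ r
  ... | yes _ = C ++ L r
  ... | no _ = L r

  count-addAt : ∀ q C L r t → count (addAt q C L r) t ≡ δ q r * count C t + count (L r) t
  count-addAt q C L r t with q ≟ r
  ... | yes _ = trans (count-++ C (L r) t) (cong (_+ count (L r) t) (sym (ℕP.+-identityʳ (count C t))))
  ... | no _ = refl

  record ClosedWalkDecomposition (Good : Q → Set) (X : T → ℕ) : Set where
    field
      walks       : Q → List T
      walks-close : ∀ r → Walk r r (walks r)
      walks-good  : ∀ r → ¬ Good r → walks r ≡ []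
      walks-count : ∀ t → ∑ℕ (λ r → count (walks r) t) ≡ X t

  record CycleSplit (X : T → ℕ) (t : T) : Set where
    field
      cycle          : List T
      remainder      : T → ℕ
      cycle-closed   : Walk (src A t) (src A t) cycle
      cycle-uses-t   : 1 ≤ count cycle t
      split-count    : ∀ s → count cycle s + remainder s ≡ X s
      remainder-circ : Circulation remainder

  splitCycle : ∀ X {t} → Circulation X → 1 ≤ X t → CycleSplit X t
  splitCycle X {t} X-circ 1≤Xt =
    let W , X′ , w , W+X′≡X₁ , X′-circ = walkAlong _ (X -δ t) refl (circulation-step X X-circ 1≤Xt) in
    record { cycle = t ∷ W ; remainder = X′ ; cycle-closed = cons t refl w
           ; cycle-uses-t = subst (_≤ count (t ∷ W) t) (δ-refl t) (ℕP.m≤m+n _ _)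
           ; split-count = count-∷ X {W = W} 1≤Xt W+X′≡X₁ ; remainder-circ = X′-circ }

  module _ {Good : Q → Set} where

    noWalks : ∀ X → ∑ℕ X ≡ 0 → ClosedWalkDecomposition Good X
    noWalks X ∑X≡0 = record
      { walks = λ _ → [] ; walks-close = λ _ → nil ; walks-good = λ _ _ → refl
      ; walks-count = λ t → trans (ℕΣ.sum-replicate-zero (nQ A)) (sym (∑ℕ≡0⇒≡0 X ∑X≡0 t)) }

    decomposeBelow : ∀ fuel X → ∑ℕ X ≤ fuel → Circulation X → (∀ t → 1 ≤ X t → Good (src A t)) →
      ClosedWalkDecomposition Good X
    decomposeBelow zero X ∑X≤0 _ _ = noWalks X (ℕP.n≤0⇒n≡0 ∑X≤0)
    decomposeBelow (suc fuel) X ∑X≤fuel X-circ X-good with ∑ℕ X ℕ.≟ 0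
    ... | yes ∑X≡0 = noWalks X ∑X≡0
    ... | no ∑X≢0 = addClosedWalk (∑ℕ-pos⇒∃pos X (ℕP.n≢0⇒n>0 ∑X≢0))
      where
      addClosedWalk : (∃ λ t → 1 ≤ X t) → ClosedWalkDecomposition Good X
      addClosedWalk (t₀ , 1≤Xt₀) = record
        { walks = addAt q C L ; walks-close = close′ ; walks-good = good′ ; walks-count = count′ }
        where
        q : Q
        q = src A t₀
        open CycleSplit (splitCycle X X-circ 1≤Xt₀) renaming (cycle to C; remainder to X′)
        ∑X′<∑X : suc (∑ℕ X′) ≤ ∑ℕ X
        ∑X′<∑X = subst (suc (∑ℕ X′) ≤_) (trans (sym (ℕΣ.∑-distrib-+ (count C) X′)) (ℕΣ.sum-cong-≗ split-count))
          (ℕP.+-monoˡ-≤ (∑ℕ X′) (ℕP.≤-trans cycle-uses-t (term≤∑ℕ (count C) t₀)))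
        rest : ClosedWalkDecomposition Good X′
        rest = decomposeBelow fuel X′ (ℕP.≤-pred (ℕP.≤-trans ∑X′<∑X ∑X≤fuel)) remainder-circ
                 (λ t 1≤X′t → X-good t (ℕP.≤-trans 1≤X′t (subst (X′ t ≤_) (split-count t) (ℕP.m≤n+m _ _))))
        open ClosedWalkDecomposition rest renaming (walks to L)
        close′ : ∀ r → Walk r r (addAt q C L r)
        close′ r with q ≟ r
        ... | yes refl = walk-++ cycle-closed (walks-close r)
        ... | no _ = walks-close r
        good′ : ∀ r → ¬ Good r → addAt q C L r ≡ []
        good′ r ¬good with q ≟ r
        ... | yes refl = ⊥-elim (¬good (X-good t₀ 1≤Xt₀))
        ... | no _ = walks-good r ¬good
        count′ : ∀ t → ∑ℕ (λ r → count (addAt q C L r) t) ≡ X t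
        count′ t = begin
          ∑ℕ (λ r → count (addAt q C L r) t)
            ≡⟨ ℕΣ.sum-cong-≗ (λ r → count-addAt q C L r t) ⟩
          ∑ℕ (λ r → δ q r * count C t + count (L r) t)
            ≡⟨ ℕΣ.∑-distrib-+ (λ r → δ q r * count C t) _ ⟩
          ∑ℕ (λ r → δ q r * count C t) + ∑ℕ (λ r → count (L r) t)
            ≡⟨ cong₂ _+_ (∑ℕ-δ q (λ _ → count C t)) (walks-count t) ⟩
          count C t + X′ t
            ≡⟨ split-count t ⟩
          X t ∎
          where open ≡-Reasoning

    decompose : ∀ X → Circulation X → (∀ t → 1 ≤ X t → Good (src A t)) → ClosedWalkDecomposition Good X
    decompose X = decomposeBelow (∑ℕ X) X ℕP.≤-refl

  walk-concat : ∀ {p n} (f : Fin n → List T) → (∀ r → Walk p p (f r)) → Walk p p (concat (tabulate f))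
  walk-concat {n = zero} f w = nil
  walk-concat {n = suc n} f w = walk-++ (w zero) (walk-concat (λ r → f (suc r)) (λ r → w (suc r)))

  count-concat : ∀ {n} (f : Fin n → List T) t → count (concat (tabulate f)) t ≡ ∑ℕ (λ r → count (f r) t)
  count-concat {zero} f t = refl
  count-concat {suc n} f t = trans (count-++ (f zero) _ t) (cong (count (f zero) t +_) (count-concat (λ r → f (suc r)) t))

  count-∉ : ∀ {P : T → Set} ts {t} → All P ts → ¬ P t → count ts t ≡ 0
  count-∉ [] _ _ = refl
  count-∉ (s ∷ ts) {t} (Ps ∷ Pts) ¬Pt with s ≟ t
  ... | yes refl = ⊥-elim (¬Pt Ps)
  ... | no _ = count-∉ ts Pts ¬Pt

  nonempty⇒count-pos : ∀ ts → 1 ≤ length ts → ∃ λ t → 1 ≤ count ts t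
  nonempty⇒count-pos (t ∷ ts) _ = t , subst (_≤ count (t ∷ ts) t) (δ-refl t) (ℕP.m≤m+n _ _)

  count-pos⇒nonempty : ∀ ts {t} → 1 ≤ count ts t → 1 ≤ length ts
  count-pos⇒nonempty (_ ∷ _) _ = s≤s z≤n

module Pumping {d : ℕ} (A : VASS d) where
  open import Data.Nat as ℕ using (zero; suc; _+_; _*_; _≤_; _∸_)
  import Data.Nat.Properties as ℕP
  open import Data.Integer as ℤ using (ℤ; +_; -[1+_])
  import Data.Integer.Properties as ℤP
  open import Data.Fin using (Fin)
  open import Data.List using (List; []; _∷_; length)
  open import Data.Product using (∃; _×_; _,_; proj₁; proj₂)
  open import Relation.Binary.PropositionalEquality using (_≡_; refl; cong; cong₂; trans; sym; subst; module ≡-Reasoning)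
  open Walks A
  open Sums

  effect : List T → Fin d → ℤ
  effect [] i = + 0
  effect (t ∷ ts) i = upd A t i ℤ.+ effect ts i

  effect-count : ∀ W i → effect W i ≡ ∑ℤ (λ t → + count W t ℤ.* upd A t i)
  effect-count [] i = sym (∑ℤ-weighted-0 (λ t → upd A t i))
  effect-count (s ∷ ts) i = sym (begin
    ∑ℤ (λ t → + (δ s t + count ts t) ℤ.* upd A t i)
      ≡⟨ ∑ℤ-weighted-+ (λ t → upd A t i) (δ s) (count ts) ⟩
    ∑ℤ (λ t → + δ s t ℤ.* upd A t i) ℤ.+ ∑ℤ (λ t → + count ts t ℤ.* upd A t i)
      ≡⟨ cong₂ ℤ._+_ (∑ℤ-δ s (λ t → upd A t i)) (sym (effect-count ts i)) ⟩
    upd A s i ℤ.+ effect ts i ∎)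
    where open ≡-Reasoning

  -- From counter values at least demand W, no counter can drop below 0 while executing W.
  demand : List T → Fin d → ℕ
  demand [] i = 0
  demand (t ∷ ts) i = ℤ.∣ upd A t i ∣ + demand ts i

  applyUpdate : ∀ n u a → ℤ.∣ u ∣ + a ≤ n → ∃ λ n′ → + n′ ≡ + n ℤ.+ u × a ≤ n′
  applyUpdate n (+ k) a k+a≤n = n + k , ℤP.pos-+ n k , ℕP.≤-trans (ℕP.m≤n+m a k) (ℕP.≤-trans k+a≤n (ℕP.m≤m+n n k))
  applyUpdate n -[1+ k ] a k+a≤n = n ∸ suc k , sym (ℤP.⊖-≥ (ℕP.≤-trans (ℕP.m≤m+n (suc k) a) k+a≤n)) ,
    subst (_≤ n ∸ suc k) (ℕP.m+n∸m≡n (suc k) a) (ℕP.∸-monoˡ-≤ (suc k) k+a≤n)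

  execute : ∀ {p q W} → Walk p q W → ∀ v → (∀ i → demand W i ≤ v i) → ∀ {m} →
    (∀ v′ → (∀ i → + v′ i ≡ + v i ℤ.+ effect W i) → Comp A (q , v′) m) → Comp A (p , v) (length W + m)
  execute nil v _ continue = continue v (λ i → sym (ℤP.+-identityʳ (+ v i)))
  execute {W = t ∷ ts} (cons t src≡p w) v enough continue =
    step (t , src≡p , refl , λ i → proj₁ (proj₂ (next i)))
         (execute w (λ i → proj₁ (next i)) (λ i → proj₂ (proj₂ (next i)))
           (λ v′ v′≡ → continue v′ (λ i → trans (v′≡ i) (trans (cong (ℤ._+ effect ts i) (proj₁ (proj₂ (next i))))
                                                          (ℤP.+-assoc (+ v i) (upd A t i) (effect ts i))))))
    where
    next : ∀ i → ∃ λ n′ → + n′ ≡ + v i ℤ.+ upd A t i × demand ts i ≤ n′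
    next i = applyUpdate (v i) (upd A t i) (demand ts i) (enough i)

  record NonNegativeCycle : Set where
    field
      base          : Q
      cycle         : List T
      cycle-closed  : Walk base base cycle
      cycle-effect  : ∀ i → + 0 ℤ.≤ effect cycle i
      cycle-nonempty : 1 ≤ length cycle

  -- Iterating a cycle of non-negative effect never lowers the counters, so it can be repeated forever.
  nonNegativeCycle⇒nonTerminating : NonNegativeCycle → NonTerminating A
  nonNegativeCycle⇒nonTerminating record
    { base = p ; cycle = F ; cycle-closed = loop ; cycle-effect = effect≥0 ; cycle-nonempty = 1≤|F| } =
    maxFin (demand F) , λ N →
      (p , demand F) , refl , N * length F , ℕP.m≤m*n N (length F) , repeat N (demand F) (λ i → ℕP.≤-refl)
    where
    instance _ = ℕ.>-nonZero 1≤|F|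
    v≤v+effect : ∀ v i → + v i ℤ.≤ + v i ℤ.+ effect F i
    v≤v+effect v i = subst (ℤ._≤ + v i ℤ.+ effect F i) (ℤP.+-identityʳ (+ v i)) (ℤP.+-monoʳ-≤ (+ v i) (effect≥0 i))
    repeat : ∀ N v → (∀ i → demand F i ≤ v i) → Comp A (p , v) (N * length F)
    repeat zero v _ = done
    repeat (suc N) v enough = execute loop v enough λ v′ v′≡ →
      repeat N v′ (λ i → ℕP.≤-trans (enough i) (ℤP.drop‿+≤+ (subst (+ v i ℤ.≤_) (sym (v′≡ i)) (v≤v+effect v i))))

module Tour {d : ℕ} {A : VASS d} (S : SubVASS A) (S-connected : StronglyConnected S) where
  open import Data.Nat using (_+_; _≤_; z≤n; s≤s)
  import Data.Nat.Properties as ℕP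
  open import Data.Fin.Subset using (_∈_; _∉_)
  open import Data.Fin.Subset.Properties using (_∈?_)
  open import Data.List using (List; []; _∷_; _++_; [_]; length; concat; tabulate)
  open import Data.List.Relation.Unary.All using (All; []; _∷_)
  import Data.List.Relation.Unary.All.Properties as AllP
  open import Data.Product using (∃; _,_; proj₁; proj₂)
  open import Data.Empty using (⊥-elim)
  open import Relation.Nullary using (yes; no)
  open import Relation.Binary.PropositionalEquality using (_≡_; refl; cong; sym; subst; module ≡-Reasoning)
  open Sums
  open Walks A

  InS : T → Set
  InS t = t ∈ Ts S

  record WalkInS (p q : Q) : Set where
    field
      steps       : List T
      steps-walk  : Walk p q steps
      steps-inS   : All InS steps
      steps-nonempty : 1 ≤ length steps
  open WalkInS

  pathWalk : ∀ {p q} → Path A InS p q → WalkInS p q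
  pathWalk (edge t t∈S) = record
    { steps = [ t ] ; steps-walk = cons t refl nil ; steps-inS = t∈S ∷ [] ; steps-nonempty = s≤s z≤n }
  pathWalk (cons t t∈S path) = let w = pathWalk path in
    record { steps = t ∷ steps w ; steps-walk = cons t refl (steps-walk w)
           ; steps-inS = t∈S ∷ steps-inS w ; steps-nonempty = s≤s z≤n }

  p₀ : Q
  p₀ = proj₁ (nonempty S)

  p₀∈S : p₀ ∈ Qs S
  p₀∈S = proj₂ (nonempty S)

  outWalk : ∀ r → r ∈ Qs S → WalkInS p₀ r
  outWalk r r∈S = pathWalk (S-connected p₀ r p₀∈S r∈S)

  backWalk : ∀ r → r ∈ Qs S → WalkInS r p₀
  backWalk r r∈S = pathWalk (S-connected r p₀ r∈S p₀∈S)

  out back : ∀ r → r ∈ Qs S → List T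
  out r r∈S = steps (outWalk r r∈S)
  back r r∈S = steps (backWalk r r∈S)

  detour : (Q → List T) → Q → List T
  detour L r with r ∈? Qs S
  ... | yes r∈S = out r r∈S ++ L r ++ back r r∈S
  ... | no _ = []

  tour : (Q → List T) → List T
  tour L = concat (tabulate (detour L))

  tour-closed : ∀ L → (∀ r → Walk r r (L r)) → Walk p₀ p₀ (tour L)
  tour-closed L L-closed = walk-concat (detour L) detour-closed
    where
    detour-closed : ∀ r → Walk p₀ p₀ (detour L r)
    detour-closed r with r ∈? Qs S
    ... | yes r∈S = walk-++ (steps-walk (outWalk r r∈S)) (walk-++ (L-closed r) (steps-walk (backWalk r r∈S)))
    ... | no _ = nil

  z : T → ℕ
  z = count (tour (λ _ → []))

  count-tour : ∀ L → (∀ r → r ∉ Qs S → L r ≡ []) → ∀ t → count (tour L) t ≡ z t + ∑ℕ (λ r → count (L r) t)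
  count-tour L L-outside t = begin
    count (tour L) t
      ≡⟨ count-concat (detour L) t ⟩
    ∑ℕ (λ r → count (detour L r) t)
      ≡⟨ ℕΣ.sum-cong-≗ count-detour ⟩
    ∑ℕ (λ r → count (detour (λ _ → []) r) t + count (L r) t)
      ≡⟨ ℕΣ.∑-distrib-+ (λ r → count (detour (λ _ → []) r) t) _ ⟩
    ∑ℕ (λ r → count (detour (λ _ → []) r) t) + ∑ℕ (λ r → count (L r) t)
      ≡⟨ cong (_+ _) (count-concat (detour (λ _ → [])) t) ⟨
    z t + ∑ℕ (λ r → count (L r) t) ∎
    where
    open ≡-Reasoning
    count-detour : ∀ r → count (detour L r) t ≡ count (detour (λ _ → []) r) t + count (L r) t
    count-detour r with r ∈? Qs S
    ... | yes r∈S = begin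
      count (out r r∈S ++ L r ++ back r r∈S) t
        ≡⟨ count-++ (out r r∈S) _ t ⟩
      count (out r r∈S) t + count (L r ++ back r r∈S) t
        ≡⟨ cong (count (out r r∈S) t +_) (count-++ (L r) _ t) ⟩
      count (out r r∈S) t + (count (L r) t + count (back r r∈S) t)
        ≡⟨ +-CS.x∙yz≈xz∙y (count (out r r∈S) t) _ _ ⟩
      count (out r r∈S) t + count (back r r∈S) t + count (L r) t
        ≡⟨ cong (_+ count (L r) t) (count-++ (out r r∈S) _ t) ⟨
      count (out r r∈S ++ back r r∈S) t + count (L r) t ∎
    ... | no r∉S rewrite L-outside r r∉S = refl

  z-circulation : Circulation z
  z-circulation r = ℕP.+-cancelʳ-≡ (δ p₀ r) _ _ (walk-flow (tour-closed (λ _ → []) (λ _ → nil)) r)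

  z-outside : ∀ t → t ∉ Ts S → z t ≡ 0
  z-outside t = count-∉ (tour (λ _ → [])) (AllP.concat⁺ (AllP.tabulate⁺ detour-inS))
    where
    detour-inS : ∀ r → All InS (detour (λ _ → []) r)
    detour-inS r with r ∈? Qs S
    ... | yes r∈S = AllP.++⁺ (steps-inS (outWalk r r∈S)) (steps-inS (backWalk r r∈S))
    ... | no _ = []

  z-pos : ∃ λ t → 1 ≤ z t
  z-pos = let t , 1≤count = detour-pos in
    t , ℕP.≤-trans 1≤count (subst (count (detour (λ _ → []) p₀) t ≤_) (sym (count-concat (detour (λ _ → [])) t))
                              (term≤∑ℕ (λ r → count (detour (λ _ → []) r) t) p₀))
    where
    detour-pos : ∃ λ t → 1 ≤ count (detour (λ _ → []) p₀) t
    detour-pos with p₀ ∈? Qs S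
    ... | no p₀∉S = ⊥-elim (p₀∉S p₀∈S)
    ... | yes p₀∈S′ =
      let t , 1≤count = nonempty⇒count-pos (out p₀ p₀∈S′) (steps-nonempty (outWalk p₀ p₀∈S′)) in
      t , ℕP.≤-trans 1≤count (subst (count (out p₀ p₀∈S′) t ≤_) (sym (count-++ (out p₀ p₀∈S′) _ t)) (ℕP.m≤m+n _ _))

module Ranking {d : ℕ} (A : VASS d) where
  open import Data.Nat as ℕ using (zero; suc)
  open import Data.Integer as ℤ using (ℤ; +_; -[1+_])
  import Data.Integer.Properties as ℤP
  open import Data.Integer.Tactic.RingSolver using (solve-∀)
  open import Data.Rational using (1ℚ) renaming (_+_ to _+ℚ_; _*_ to _*ℚ_; _-_ to _-ℚ_; _≤_ to _≤ℚ_; -_ to -ℚ_)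
  import Data.Rational.Properties as ℚP
  open import Data.Fin using (Fin; zero; suc)
  open import Data.Fin.Subset using (_∈_)
  open import Data.Fin.Subset.Properties using (_∈?_)
  open import Data.List using (length; allFin)
  open import Data.List.Relation.Unary.All as All using ()
  open import Data.List.Membership.Propositional using (lose)
  import Data.List.Membership.Propositional.Properties as ∈P
  import Data.List.Properties as ListP
  open import Data.Product using (_×_; _,_)
  open import Relation.Nullary using (¬_; Dec)
  open import Relation.Nullary.Decidable using (_×-dec_)
  open import Relation.Binary.PropositionalEquality using (_≡_; cong; cong₂; trans; sym; subst; subst₂)
  open FourierMotzkin using (ι; ι≡/1; ι-0; ι-+; ι-*; ι-mono-≤; ι-cancel-≤; _·ℤ_)

  integralMap : (Fin d → ℤ) → (Fin (nQ A) → ℤ) → LinMap A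
  integralMap c w = record { c = λ i → ι (c i) ; w = λ q → ι (w q) }

  slack : (Fin d → ℤ) → (Fin (nQ A) → ℤ) → Fin (nT A) → ℤ
  slack c w t = w (src A t) ℤ.- (c ·ℤ upd A t ℤ.+ w (tgt A t))

  dot-ι : ∀ {k} (c u : Fin k → ℤ) → dot (λ i → ι (c i)) u ≡ ι (c ·ℤ u)
  dot-ι {zero} c u = sym ι-0
  dot-ι {suc k} c u = trans (cong₂ _+ℚ_ (trans (cong (ι (c zero) *ℚ_) (ι≡/1 (u zero))) (sym (ι-* (c zero) (u zero))))
                                    (dot-ι (λ i → c (suc i)) (λ i → u (suc i))))
                            (sym (ι-+ (c zero ℤ.* u zero) ((λ i → c (suc i)) ·ℤ (λ i → u (suc i)))))

  module _ (c : Fin d → ℤ) (w : Fin (nQ A) → ℤ) (t : Fin (nT A)) where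

    private
      f : LinMap A
      f = integralMap c w

      image : dot (LinMap.c f) (upd A t) +ℚ LinMap.w f (tgt A t) ≡ ι (c ·ℤ upd A t ℤ.+ w (tgt A t))
      image = trans (cong (_+ℚ ι (w (tgt A t))) (dot-ι c (upd A t))) (sym (ι-+ (c ·ℤ upd A t) (w (tgt A t))))

      rearrange : ∀ a b → + 1 ℤ.≤ b ℤ.- a → a ℤ.≤ b ℤ.+ -[1+ 0 ]
      rearrange a b 1≤b-a = subst₂ ℤ._≤_ (a+1-1 a) (a+[b-a]-1 a b) (ℤP.+-monoʳ-≤ (a ℤ.+ -[1+ 0 ]) 1≤b-a)
        where
        a+1-1 : ∀ a → a ℤ.+ -[1+ 0 ] ℤ.+ + 1 ≡ a
        a+1-1 = solve-∀
        a+[b-a]-1 : ∀ a b → a ℤ.+ -[1+ 0 ] ℤ.+ (b ℤ.- a) ≡ b ℤ.+ -[1+ 0 ]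
        a+[b-a]-1 = solve-∀

    slack-pos⇒ranked : + 1 ℤ.≤ slack c w t → Ranked f t
    slack-pos⇒ranked 1≤slack = subst₂ _≤ℚ_ (sym image)
      (trans (ι-+ (w (src A t)) -[1+ 0 ]) (cong (ι (w (src A t)) +ℚ_) (cong -ℚ_ (sym (ι≡/1 (+ 1))))))
      (ι-mono-≤ (rearrange (c ·ℤ upd A t ℤ.+ w (tgt A t)) (w (src A t)) 1≤slack))

    slack-zero⇒neutral : slack c w t ≡ + 0 → Neutral f t
    slack-zero⇒neutral slack≡0 = trans image (cong ι (sym (ℤP.i-j≡0⇒i≡j _ _ slack≡0)))

  y≰y-1 : ∀ y → ¬ (y ≤ℚ y -ℚ 1ℚ)
  y≰y-1 y y≤y-1 = 0≰-1 (ι-cancel-≤ (subst₂ _≤ℚ_ (trans (ℚP.+-inverseˡ y) (sym ι-0)) -y+[y-1]≡-1 (ℚP.+-monoʳ-≤ (-ℚ y) y≤y-1)))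
    where
    0≰-1 : ¬ (+ 0 ℤ.≤ -[1+ 0 ])
    0≰-1 ()
    -y+[y-1]≡-1 : -ℚ y +ℚ (y -ℚ 1ℚ) ≡ ι -[1+ 0 ]
    -y+[y-1]≡-1 = trans (sym (ℚP.+-assoc (-ℚ y) y (-ℚ 1ℚ)))
      (trans (cong (_+ℚ -ℚ 1ℚ) (ℚP.+-inverseˡ y)) (trans (ℚP.+-identityˡ (-ℚ 1ℚ)) (cong -ℚ_ (ι≡/1 (+ 1)))))

  neutral⇒¬ranked : ∀ (f : LinMap A) t → Neutral f t → ¬ Ranked f t
  neutral⇒¬ranked f t neutral ranked = y≰y-1 (LinMap.w f (src A t)) (subst (_≤ℚ LinMap.w f (src A t) -ℚ 1ℚ) neutral ranked)

  module _ (S : SubVASS A) (f : LinMap A) where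

    private
      RankedInS? : ∀ t → Dec (t ∈ Ts S × Ranked f t)
      RankedInS? t = (t ∈? Ts S) ×-dec Ranked? f t

    ranked⇒numRanked-pos : ∀ t → t ∈ Ts S → Ranked f t → 0 ℕ.< numRanked S f
    ranked⇒numRanked-pos t t∈S ranked = ListP.filter-some RankedInS? (lose (∈P.∈-allFin t) (t∈S , ranked))

    neutral⇒numRanked≡0 : (∀ t → t ∈ Ts S → Neutral f t) → numRanked S f ≡ 0
    neutral⇒numRanked≡0 neutral = cong length (ListP.filter-none RankedInS? {xs = allFin (nT A)}
      (All.tabulate (λ {t} _ (t∈S , ranked) → neutral⇒¬ranked f t (neutral t t∈S) ranked)))

module RankingSystem {d : ℕ} {A : VASS d} (S : SubVASS A) (S-connected : StronglyConnected S) where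
  open import Data.Nat using (suc; _+_; _*_; _≤_; _∸_; z≤n; s≤s)
  import Data.Nat.Properties as ℕP
  open import Data.Integer as ℤ using (ℤ; +_; +[1+_])
  import Data.Integer.Properties as ℤP
  open import Data.Integer.Tactic.RingSolver using (solve-∀)
  open import Data.Fin using (Fin; _↑ˡ_; _↑ʳ_)
  open import Data.Fin.Subset using (_∈_; _∉_)
  open import Data.Fin.Subset.Properties using (_∈?_)
  import Data.Vec.Functional as Vector
  import Data.Vec.Functional.Properties as VectorP
  open import Data.List using (List; []; _∷_; _++_; [_]; map; tabulate; filter; allFin)
  open import Data.List.Relation.Unary.All as All using (All; []; _∷_)
  import Data.List.Relation.Unary.All.Properties as AllP
  open import Data.List.Membership.Propositional.Properties using (∈-filter⁺; ∈-allFin)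
  open import Data.Product using (∃; _×_; _,_; proj₁; proj₂; uncurry)
  open import Data.Sum using (_⊎_; inj₁; inj₂; [_,_]′)
  open import Data.Rational using () renaming (_≤_ to _≤ℚ_)
  open import Relation.Nullary using (yes; no; ¬_)
  open import Data.Empty using (⊥-elim)
  open import Relation.Binary.PropositionalEquality using (_≡_; refl; cong; cong₂; trans; sym; subst; module ≡-Reasoning)
  open Sums
  open FourierMotzkin
  open Walks A
  open Tour S S-connected
  open Ranking A
  open Pumping A

  N : ℕ
  N = d + nQ A

  coeffs : (Fin N → ℤ) → Fin d → ℤ
  coeffs x i = x (i ↑ˡ nQ A)

  weights : (Fin N → ℤ) → Q → ℤ
  weights x q = x (d ↑ʳ q)

  ·ℤ-++ : ∀ (a : Fin d → ℤ) (b : Q → ℤ) x → (a Vector.++ b) ·ℤ x ≡ a ·ℤ coeffs x ℤ.+ b ·ℤ weights x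
  ·ℤ-++ a b x = trans (∑ℤ-↑ {d} {nQ A} (λ j → (a Vector.++ b) j ℤ.* x j))
    (cong₂ ℤ._+_ (ℤΣ.sum-cong-≗ (λ i → cong (ℤ._* coeffs x i) (VectorP.lookup-++ˡ a b i)))
                 (ℤΣ.sum-cong-≗ (λ q → cong (ℤ._* weights x q) (VectorP.lookup-++ʳ a b q))))

  Δ : T → Q → ℤ
  Δ t q = + δ (src A t) q ℤ.- + δ (tgt A t) q

  Δ-·ℤ : ∀ t (w : Q → ℤ) → Δ t ·ℤ w ≡ w (src A t) ℤ.- w (tgt A t)
  Δ-·ℤ t w = begin
    ∑ℤ (λ q → Δ t q ℤ.* w q)
      ≡⟨ ℤΣ.sum-cong-≗ distrib ⟩
    ∑ℤ (λ q → + δ (src A t) q ℤ.* w q ℤ.+ ℤ.- (+ δ (tgt A t) q ℤ.* w q))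
      ≡⟨ ℤΣ.∑-distrib-+ (λ q → + δ (src A t) q ℤ.* w q) _ ⟩
    ∑ℤ (λ q → + δ (src A t) q ℤ.* w q) ℤ.+ ∑ℤ (λ q → ℤ.- (+ δ (tgt A t) q ℤ.* w q))
      ≡⟨ cong (ℤ._+_ (∑ℤ (λ q → + δ (src A t) q ℤ.* w q))) (∑ℤ-neg (λ q → + δ (tgt A t) q ℤ.* w q)) ⟩
    ∑ℤ (λ q → + δ (src A t) q ℤ.* w q) ℤ.- ∑ℤ (λ q → + δ (tgt A t) q ℤ.* w q)
      ≡⟨ cong₂ ℤ._-_ (∑ℤ-δ (src A t) w) (∑ℤ-δ (tgt A t) w) ⟩
    w (src A t) ℤ.- w (tgt A t) ∎
    where
    open ≡-Reasoning
    distrib : ∀ q → Δ t q ℤ.* w q ≡ + δ (src A t) q ℤ.* w q ℤ.+ ℤ.- (+ δ (tgt A t) q ℤ.* w q)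
    distrib q = trans (ℤP.*-distribʳ-+ (w q) (+ δ (src A t) q) (ℤ.- + δ (tgt A t) q))
                      (cong (ℤ._+_ (+ δ (src A t) q ℤ.* w q)) (sym (ℤP.neg-distribˡ-* (+ δ (tgt A t) q) (w q))))

  -- The coefficients, over the unknowns (c , w), of the slack  w(src t) - c·u_t - w(tgt t)  of t.
  slackRow : T → Fin N → ℤ
  slackRow t = (λ i → ℤ.- upd A t i) Vector.++ Δ t

  slackRow-·ℤ : ∀ t x → slackRow t ·ℤ x ≡ slack (coeffs x) (weights x) t
  slackRow-·ℤ t x = begin
    slackRow t ·ℤ x
      ≡⟨ ·ℤ-++ (λ i → ℤ.- upd A t i) (Δ t) x ⟩
    (λ i → ℤ.- upd A t i) ·ℤ coeffs x ℤ.+ Δ t ·ℤ weights x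
      ≡⟨ cong₂ ℤ._+_ neg-· (Δ-·ℤ t (weights x)) ⟩
    ℤ.- (coeffs x ·ℤ upd A t) ℤ.+ (weights x (src A t) ℤ.- weights x (tgt A t))
      ≡⟨ rearrange (coeffs x ·ℤ upd A t) (weights x (src A t)) (weights x (tgt A t)) ⟩
    slack (coeffs x) (weights x) t ∎
    where
    open ≡-Reasoning
    neg-· : (λ i → ℤ.- upd A t i) ·ℤ coeffs x ≡ ℤ.- (coeffs x ·ℤ upd A t)
    neg-· = trans (ℤΣ.sum-cong-≗ (λ i → trans (sym (ℤP.neg-distribˡ-* (upd A t i) (coeffs x i)))
                                              (cong ℤ.-_ (ℤP.*-comm (upd A t i) (coeffs x i)))))
                  (∑ℤ-neg (λ i → coeffs x i ℤ.* upd A t i))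
    rearrange : ∀ a b e → ℤ.- a ℤ.+ (b ℤ.- e) ≡ b ℤ.- (a ℤ.+ e)
    rearrange = solve-∀

  coeffRow : Fin d → Fin N → ℤ
  coeffRow i = (λ i′ → + δ i i′) Vector.++ (λ _ → + 0)

  tourRow : Fin N → ℤ
  tourRow j = ∑ℤ (λ t → + z t ℤ.* slackRow t j)

  transitionsOfS : List T
  transitionsOfS = filter (_∈? Ts S) (allFin (nT A))

  -- An integral solution (c , w) is a QRF of S (c ≥ 0 and every transition of S has slack ≥ 0)
  -- whose slacks along the tour add up to at least 1.
  system : List (Row N)
  system = tabulate (λ i → coeffRow i , + 0) ++ map (λ t → slackRow t , + 0) transitionsOfS ++ [ tourRow , + 1 ]

  system-nonNeg : All (λ r → + 0 ℤ.≤ proj₂ r) system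
  system-nonNeg = AllP.++⁺ (AllP.tabulate⁺ {f = λ i → coeffRow i , + 0} (λ _ → ℤ.+≤+ z≤n))
                           (AllP.++⁺ (AllP.map⁺ (All.tabulate {xs = transitionsOfS} (λ _ → ℤ.+≤+ z≤n))) (ℤ.+≤+ z≤n ∷ []))

  -- Non-negative combinations of the rows of the system: γ for the rows c ≥ 0, Y for the slack rows,
  -- where the tour row with multiplier μ is folded into Y as μ z.
  record Multipliers (a : Fin N → ℤ) (β : ℤ) : Set where
    field
      γ          : Fin d → ℕ
      Y          : T → ℕ
      μ          : ℕ
      β≡μ        : β ≡ + μ
      μz≤Y       : ∀ t → μ * z t ≤ Y t
      Y-outside  : ∀ t → t ∉ Ts S → Y t ≡ 0
      coeff-part : ∀ i → a (i ↑ˡ nQ A) ≡ + γ i ℤ.- ∑ℤ (λ t → + Y t ℤ.* upd A t i)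
      state-part : ∀ q → a (d ↑ʳ q) ≡ ∑ℤ (λ t → + Y t ℤ.* Δ t q)

  multipliers-closed : ConicallyClosed Multipliers
  multipliers-closed = record { resp = resp ; add = add ; scale = scale }
    where
    open Multipliers
    resp : ∀ {a b β} → (∀ j → a j ≡ b j) → Multipliers a β → Multipliers b β
    resp a≗b M = record
      { γ = γ M ; Y = Y M ; μ = μ M ; β≡μ = β≡μ M ; μz≤Y = μz≤Y M ; Y-outside = Y-outside M
      ; coeff-part = λ i → trans (sym (a≗b (i ↑ˡ nQ A))) (coeff-part M i)
      ; state-part = λ q → trans (sym (a≗b (d ↑ʳ q))) (state-part M q) }

    add : ∀ {a b α β} → Multipliers a α → Multipliers b β → Multipliers (λ j → a j ℤ.+ b j) (α ℤ.+ β)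
    add M M′ = record
      { γ = λ i → γ M i + γ M′ i
      ; Y = λ t → Y M t + Y M′ t
      ; μ = μ M + μ M′
      ; β≡μ = trans (cong₂ ℤ._+_ (β≡μ M) (β≡μ M′)) (sym (ℤP.pos-+ (μ M) (μ M′)))
      ; μz≤Y = λ t → subst (_≤ Y M t + Y M′ t) (sym (ℕP.*-distribʳ-+ (z t) (μ M) (μ M′)))
                           (ℕP.+-mono-≤ (μz≤Y M t) (μz≤Y M′ t))
      ; Y-outside = λ t t∉S → cong₂ _+_ (Y-outside M t t∉S) (Y-outside M′ t t∉S)
      ; coeff-part = λ i → trans (cong₂ ℤ._+_ (coeff-part M i) (coeff-part M′ i))
          (trans (interchange (+ γ M i) (+ γ M′ i) (∑ℤ (λ t → + Y M t ℤ.* upd A t i)) (∑ℤ (λ t → + Y M′ t ℤ.* upd A t i)))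
            (cong₂ ℤ._-_ (sym (ℤP.pos-+ (γ M i) (γ M′ i))) (sym (∑ℤ-weighted-+ (λ t → upd A t i) (Y M) (Y M′)))))
      ; state-part = λ q → trans (cong₂ ℤ._+_ (state-part M q) (state-part M′ q))
                                 (sym (∑ℤ-weighted-+ (λ t → Δ t q) (Y M) (Y M′))) }
      where
      interchange : ∀ g g′ s s′ → (g ℤ.- s) ℤ.+ (g′ ℤ.- s′) ≡ (g ℤ.+ g′) ℤ.- (s ℤ.+ s′)
      interchange = solve-∀

    scale : ∀ k {a β} → Multipliers a β → Multipliers (λ j → +[1+ k ] ℤ.* a j) (+[1+ k ] ℤ.* β)
    scale k M = record
      { γ = λ i → suc k * γ M i
      ; Y = λ t → suc k * Y M t
      ; μ = suc k * μ M
      ; β≡μ = trans (cong (+[1+ k ] ℤ.*_) (β≡μ M)) (sym (ℤP.pos-* (suc k) (μ M)))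
      ; μz≤Y = λ t → subst (_≤ suc k * Y M t) (sym (ℕP.*-assoc (suc k) (μ M) (z t))) (ℕP.*-monoʳ-≤ (suc k) (μz≤Y M t))
      ; Y-outside = λ t t∉S → trans (cong (suc k *_) (Y-outside M t t∉S)) (ℕP.*-zeroʳ (suc k))
      ; coeff-part = λ i → trans (cong (+[1+ k ] ℤ.*_) (coeff-part M i))
          (trans (distrib-- +[1+ k ] (+ γ M i) (∑ℤ (λ t → + Y M t ℤ.* upd A t i)))
            (cong₂ ℤ._-_ (sym (ℤP.pos-* (suc k) (γ M i))) (sym (∑ℤ-weighted-* (λ t → upd A t i) (suc k) (Y M)))))
      ; state-part = λ q → trans (cong (+[1+ k ] ℤ.*_) (state-part M q)) (sym (∑ℤ-weighted-* (λ t → Δ t q) (suc k) (Y M))) }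
      where
      distrib-- : ∀ k g s → k ℤ.* (g ℤ.- s) ≡ k ℤ.* g ℤ.- k ℤ.* s
      distrib-- = solve-∀

  coeffRow-multipliers : ∀ i → Multipliers (coeffRow i) (+ 0)
  coeffRow-multipliers i = record
    { γ = δ i ; Y = λ _ → 0 ; μ = 0 ; β≡μ = refl ; μz≤Y = λ _ → z≤n ; Y-outside = λ _ _ → refl
    ; coeff-part = λ i′ → trans (VectorP.lookup-++ˡ (λ i′ → + δ i i′) (λ _ → + 0) i′)
                                (sym (trans (cong (ℤ._-_ (+ δ i i′)) (∑ℤ-weighted-0 (λ t → upd A t i′))) (ℤP.+-identityʳ _)))
    ; state-part = λ q → trans (VectorP.lookup-++ʳ (λ i′ → + δ i i′) (λ _ → + 0) q) (sym (∑ℤ-weighted-0 (λ t → Δ t q))) }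

  slackRow-multipliers : ∀ t → t ∈ Ts S → Multipliers (slackRow t) (+ 0)
  slackRow-multipliers t t∈S = record
    { γ = λ _ → 0 ; Y = δ t ; μ = 0 ; β≡μ = refl ; μz≤Y = λ _ → z≤n
    ; Y-outside = λ s s∉S → δ-≢ (λ t≡s → s∉S (subst (_∈ Ts S) t≡s t∈S))
    ; coeff-part = λ i → trans (VectorP.lookup-++ˡ (λ i → ℤ.- upd A t i) (Δ t) i)
                               (sym (trans (cong (ℤ._-_ (+ 0)) (∑ℤ-δ t (λ s → upd A s i))) (ℤP.+-identityˡ _)))
    ; state-part = λ q → trans (VectorP.lookup-++ʳ (λ i → ℤ.- upd A t i) (Δ t) q) (sym (∑ℤ-δ t (λ s → Δ s q))) }

  tourRow-multipliers : Multipliers tourRow (+ 1)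
  tourRow-multipliers = record
    { γ = λ _ → 0 ; Y = z ; μ = 1 ; β≡μ = refl ; μz≤Y = λ t → ℕP.≤-reflexive (ℕP.*-identityˡ (z t))
    ; Y-outside = z-outside
    ; coeff-part = λ i → begin
        ∑ℤ (λ t → + z t ℤ.* slackRow t (i ↑ˡ nQ A))
          ≡⟨ ℤΣ.sum-cong-≗ (λ t → cong (+ z t ℤ.*_) (VectorP.lookup-++ˡ (λ i → ℤ.- upd A t i) (Δ t) i)) ⟩
        ∑ℤ (λ t → + z t ℤ.* ℤ.- upd A t i)
          ≡⟨ ℤΣ.sum-cong-≗ (λ t → sym (ℤP.neg-distribʳ-* (+ z t) (upd A t i))) ⟩
        ∑ℤ (λ t → ℤ.- (+ z t ℤ.* upd A t i))
          ≡⟨ ∑ℤ-neg (λ t → + z t ℤ.* upd A t i) ⟩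
        ℤ.- ∑ℤ (λ t → + z t ℤ.* upd A t i)
          ≡⟨ ℤP.+-identityˡ _ ⟨
        + 0 ℤ.- ∑ℤ (λ t → + z t ℤ.* upd A t i) ∎
    ; state-part = λ q → ℤΣ.sum-cong-≗ (λ t → cong (+ z t ℤ.*_) (VectorP.lookup-++ʳ (λ i → ℤ.- upd A t i) (Δ t) q)) }
    where open ≡-Reasoning

  system-multipliers : All (uncurry Multipliers) system
  system-multipliers = AllP.++⁺ (AllP.tabulate⁺ coeffRow-multipliers)
    (AllP.++⁺ (AllP.map⁺ (All.map (slackRow-multipliers _) (AllP.all-filter (_∈? Ts S) (allFin (nT A)))))
              (tourRow-multipliers ∷ []))

  coeffRow-·ℤ : ∀ i x → coeffRow i ·ℤ x ≡ coeffs x i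
  coeffRow-·ℤ i x = trans (·ℤ-++ (λ i′ → + δ i i′) (λ _ → + 0) x)
    (trans (cong₂ ℤ._+_ (∑ℤ-δ i (coeffs x)) (∑ℤ-weighted-0 (weights x))) (ℤP.+-identityʳ (coeffs x i)))

  tourRow-·ℤ : ∀ x → tourRow ·ℤ x ≡ ∑ℤ (λ t → + z t ℤ.* slack (coeffs x) (weights x) t)
  tourRow-·ℤ x = trans (·ℤ-∑ (λ t → + z t) slackRow x) (ℤΣ.sum-cong-≗ (λ t → cong (+ z t ℤ.*_) (slackRow-·ℤ t x)))

  nonNeg-classify : ∀ h → + 0 ℤ.≤ h → h ≡ + 0 ⊎ + 1 ℤ.≤ h
  nonNeg-classify (+ 0) _ = inj₁ refl
  nonNeg-classify +[1+ _ ] _ = inj₂ (ℤ.+≤+ (s≤s z≤n))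

  nonNeg-factor-pos : ∀ a h → + 0 ℤ.≤ h → + 1 ℤ.≤ + a ℤ.* h → + 1 ℤ.≤ h
  nonNeg-factor-pos a (+ 0) _ 1≤ah with subst (+ 1 ℤ.≤_) (ℤP.*-zeroʳ (+ a)) 1≤ah
  ... | ℤ.+≤+ ()
  nonNeg-factor-pos a +[1+ _ ] _ _ = ℤ.+≤+ (s≤s z≤n)

  module Solution (x : Fin N → ℤ) (x⊨system : All (x ⊨ℤ_) system) where

    f : LinMap A
    f = integralMap (coeffs x) (weights x)

    private
      slackₓ : T → ℤ
      slackₓ = slack (coeffs x) (weights x)
      x⊨slacks+tour : All (x ⊨ℤ_) (map (λ t → slackRow t , + 0) transitionsOfS ++ [ tourRow , + 1 ])
      x⊨slacks+tour = AllP.++⁻ʳ (tabulate (λ i → coeffRow i , + 0)) x⊨system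
      x⊨slacks : All (λ t → x ⊨ℤ (slackRow t , + 0)) transitionsOfS
      x⊨slacks = AllP.map⁻ (AllP.++⁻ˡ (map (λ t → slackRow t , + 0) transitionsOfS) x⊨slacks+tour)
      x⊨tour : x ⊨ℤ (tourRow , + 1)
      x⊨tour = All.head (AllP.++⁻ʳ (map (λ t → slackRow t , + 0) transitionsOfS) x⊨slacks+tour)

    coeffs-nonNeg : ∀ i → + 0 ℤ.≤ coeffs x i
    coeffs-nonNeg i = subst (+ 0 ℤ.≤_) (coeffRow-·ℤ i x)
      (AllP.tabulate⁻ (AllP.++⁻ˡ (tabulate (λ i → coeffRow i , + 0)) x⊨system) i)

    slack-nonNeg : ∀ t → t ∈ Ts S → + 0 ℤ.≤ slackₓ t
    slack-nonNeg t t∈S = subst (+ 0 ℤ.≤_) (slackRow-·ℤ t x) (All.lookup x⊨slacks (∈-filter⁺ (_∈? Ts S) (∈-allFin t) t∈S))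

    isQRF : IsQRF S f
    isQRF = (λ i → subst (_≤ℚ ι (coeffs x i)) ι-0 (ι-mono-≤ (coeffs-nonNeg i)))
          , λ t t∈S → [ (λ slack≡0 → inj₂ (slack-zero⇒neutral (coeffs x) (weights x) t slack≡0))
                      , (λ 1≤slack → inj₁ (slack-pos⇒ranked (coeffs x) (weights x) t 1≤slack)) ]′
                      (nonNeg-classify (slackₓ t) (slack-nonNeg t t∈S))

    rankedTransition : ∃ λ t → t ∈ Ts S × Ranked f t
    rankedTransition with ∑ℤ-pos⇒∃pos (λ t → + z t ℤ.* slackₓ t) (subst (+ 1 ℤ.≤_) (tourRow-·ℤ x) x⊨tour)
    ... | t , 1≤z*slack with t ∈? Ts S
    ...   | yes t∈S = t , t∈S ,
      slack-pos⇒ranked (coeffs x) (weights x) t (nonNeg-factor-pos (z t) (slackₓ t) (slack-nonNeg t t∈S) 1≤z*slack)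
    ...   | no t∉S with subst (λ k → + 1 ℤ.≤ + k ℤ.* slackₓ t) (z-outside t t∉S) 1≤z*slack
    ...     | ℤ.+≤+ ()

  Δ-weighted : ∀ (Y : T → ℕ) q → ∑ℤ (λ t → + Y t ℤ.* Δ t q) ≡ + outflow Y q ℤ.- + inflow Y q
  Δ-weighted Y q = begin
    ∑ℤ (λ t → + Y t ℤ.* Δ t q)
      ≡⟨ ℤΣ.sum-cong-≗ distrib ⟩
    ∑ℤ (λ t → + (δ (src A t) q * Y t) ℤ.+ ℤ.- + (δ (tgt A t) q * Y t))
      ≡⟨ ℤΣ.∑-distrib-+ (λ t → + (δ (src A t) q * Y t)) _ ⟩
    ∑ℤ (λ t → + (δ (src A t) q * Y t)) ℤ.+ ∑ℤ (λ t → ℤ.- + (δ (tgt A t) q * Y t))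
      ≡⟨ cong (ℤ._+_ (∑ℤ (λ t → + (δ (src A t) q * Y t)))) (∑ℤ-neg (λ t → + (δ (tgt A t) q * Y t))) ⟩
    ∑ℤ (λ t → + (δ (src A t) q * Y t)) ℤ.- ∑ℤ (λ t → + (δ (tgt A t) q * Y t))
      ≡⟨ cong₂ ℤ._-_ (+-∑ℕ (λ t → δ (src A t) q * Y t)) (+-∑ℕ (λ t → δ (tgt A t) q * Y t)) ⟨
    + outflow Y q ℤ.- + inflow Y q ∎
    where
    open ≡-Reasoning
    distrib : ∀ t → + Y t ℤ.* Δ t q ≡ + (δ (src A t) q * Y t) ℤ.+ ℤ.- + (δ (tgt A t) q * Y t)
    distrib t = trans (expand (+ Y t) (+ δ (src A t) q) (+ δ (tgt A t) q))
                      (sym (cong₂ ℤ._-_ (ℤP.pos-* (δ (src A t) q) (Y t)) (ℤP.pos-* (δ (tgt A t) q) (Y t))))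
      where
      expand : ∀ y a b → y ℤ.* (a ℤ.- b) ≡ a ℤ.* y ℤ.- b ℤ.* y
      expand = solve-∀

  -- A derivation of 0 ≥ 1 + k weights the transitions by a circulation Y ≥ z of non-negative effect;
  -- the closed walks of Y - z, spliced into the tour, give a cycle with exactly these multiplicities.
  contradiction⇒cycle : Contradiction Multipliers → NonNegativeCycle
  contradiction⇒cycle (k , M) = record
    { base = p₀ ; cycle = tour L ; cycle-closed = tour-closed L walks-close
    ; cycle-effect = λ i → subst (+ 0 ℤ.≤_) (sym (tourL-effect i)) (ℤ.+≤+ z≤n)
    ; cycle-nonempty = let t , 1≤zt = z-pos in
        count-pos⇒nonempty (tour L) (subst (1 ≤_) (sym (count-tourL t)) (ℕP.≤-trans 1≤zt (z≤Y t))) }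
    where
    open Multipliers M
    z≤Y : ∀ t → z t ≤ Y t
    z≤Y t = ℕP.≤-trans (subst (λ μ → z t ≤ μ * z t) (ℤP.+-injective β≡μ) (ℕP.m≤m+n (z t) (k * z t))) (μz≤Y t)
    Y-effect : ∀ i → ∑ℤ (λ t → + Y t ℤ.* upd A t i) ≡ + γ i
    Y-effect i = sym (ℤP.i-j≡0⇒i≡j _ _ (sym (coeff-part i)))
    Y-circulation : Circulation Y
    Y-circulation q = sym (ℤP.+-injective (ℤP.i-j≡0⇒i≡j _ _ (trans (sym (Δ-weighted Y q)) (sym (state-part q)))))
    X : T → ℕ
    X t = Y t ∸ z t
    X+z≡Y : ∀ t → X t + z t ≡ Y t
    X+z≡Y t = ℕP.m∸n+n≡m (z≤Y t)
    X-circulation : Circulation X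
    X-circulation r = ℕP.+-cancelʳ-≡ (inflow z r) _ _ (begin
      inflow X r + inflow z r     ≡⟨ flow-+ (tgt A) X z r ⟨
      inflow (λ t → X t + z t) r  ≡⟨ flow-cong (tgt A) r X+z≡Y ⟩
      inflow Y r                  ≡⟨ Y-circulation r ⟩
      outflow Y r                 ≡⟨ flow-cong (src A) r X+z≡Y ⟨
      outflow (λ t → X t + z t) r ≡⟨ flow-+ (src A) X z r ⟩
      outflow X r + outflow z r   ≡⟨ cong (_+_ (outflow X r)) (z-circulation r) ⟨
      outflow X r + inflow z r ∎)
      where open ≡-Reasoning
    X-inS : ∀ t → 1 ≤ X t → src A t ∈ Qs S
    X-inS t 1≤Xt with t ∈? Ts S
    ... | yes t∈S = proj₁ (closed S t t∈S)
    ... | no t∉S with subst (λ y → 1 ≤ y ∸ z t) (Y-outside t t∉S) 1≤Xt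
    ...   | 1≤0∸z rewrite ℕP.0∸n≡0 (z t) with 1≤0∸z
    ...     | ()
    open ClosedWalkDecomposition (decompose {Good = _∈ Qs S} X X-circulation X-inS) renaming (walks to L)
    count-tourL : ∀ t → count (tour L) t ≡ Y t
    count-tourL t = trans (count-tour L walks-good t) (trans (cong (_+_ (z t)) (walks-count t)) (trans (ℕP.+-comm (z t) (X t)) (X+z≡Y t)))
    tourL-effect : ∀ i → effect (tour L) i ≡ + γ i
    tourL-effect i = trans (effect-count (tour L) i)
      (trans (ℤΣ.sum-cong-≗ (λ t → cong (λ n → + n ℤ.* upd A t i) (count-tourL t))) (Y-effect i))

  noRankingQRF⇒cycle : (∀ g → IsQRF S g → ∀ t → t ∈ Ts S → ¬ Ranked g t) → NonNegativeCycle
  noRankingQRF⇒cycle unrankable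
    with fourierMotzkinℤ N Multipliers multipliers-closed system system-multipliers system-nonNeg
  ... | inj₂ contra = contradiction⇒cycle contra
  ... | inj₁ (x , x⊨system) =
    let open Solution x x⊨system
        t , t∈S , ranked = rankedTransition
    in ⊥-elim (unrankable f isQRF t t∈S ranked)

open import Data.Product using (_,_)
import Data.Nat.Properties as ℕP
open import Data.Fin.Subset using (_∈_)
open import Relation.Nullary using (¬_)
open import Relation.Binary.PropositionalEquality using (refl; subst)
open Ranking
open Pumping

maxQRF-allNeutral⇒unrankable : ∀ {d} {A : VASS d} (S : SubVASS A) f → IsMaxQRF S f → (∀ t → t ∈ Ts S → Neutral f t) →
  ∀ g → IsQRF S g → ∀ t → t ∈ Ts S → ¬ Ranked g t
maxQRF-allNeutral⇒unrankable {A = A} S f (_ , maximal) neutral g g-QRF t t∈S ranked =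
  ℕP.<-irrefl refl (subst (0 ℕ.<_) (neutral⇒numRanked≡0 A S f neutral)
    (ℕP.<-≤-trans (ranked⇒numRanked-pos A S g t t∈S ranked) (maximal g g-QRF)))

decomposeInf⇒cycle : ∀ {d} {A : VASS d} (S : SubVASS A) → StronglyConnected S → DecomposeInf S → NonNegativeCycle A
decomposeInf⇒cycle S S-connected (allNeutral f maximal neutral) =
  RankingSystem.noRankingQRF⇒cycle S S-connected (maxQRF-allNeutral⇒unrankable S f maximal neutral)
decomposeInf⇒cycle S _ (recurse _ _ _ _ S′ (_ , _ , S′-connected , _) S′-inf) = decomposeInf⇒cycle S′ S′-connected S′-inf

-- The transition provided by the third hypothesis is not needed: every state has an outgoing one anyway.
mainTheorem4 : ∀ {d} (A : VASS d) → StronglyConnectedVASS A →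
    Fin (nT A) → Alg1ReturnsNonTerminating A → NonTerminating A
mainTheorem4 A A-connected _ returnsNonTerminating =
  nonNegativeCycle⇒nonTerminating A (decomposeInf⇒cycle (whole A) A-connected returnsNonTerminating)
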